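{- Let $\mathcal{C} = \operatorname{Av}(312, 321)$, identified with words as described in the context. Let $A$ and $B$ be words. (i) For $i \ge 1$, provided neither $A$ nor $B$ begins with a letter of the form $a^k$, the classes $\operatorname{Av}_{\mathcal{C}}(a^i A)$ and $\operatorname{Av}_{\mathcal{C}}(a^i B)$ are Wilf-equivalent if and only if $\operatorname{Av}_{\mathcal{C}}(A)$ and $\operatorname{Av}_{\mathcal{C}}(B)$ are Wilf-equivalent. (ii) For $j \ge 2$, $\operatorname{Av}_{\mathcal{C}}(b_j A)$ and $\operatorname{Av}_{\mathcal{C}}(b_j B)$ are Wilf-equivalent if and only if $\operatorname{Av}_{\mathcal{C}}(A)$ and $\operatorname{Av}_{\mathcal{C}}(B)$ are Wilf-equivalent.
   Context: For permutations $\pi,\sigma$, $\pi\preceq\sigma$ means $\sigma$ has a subsequence order-isomorphic to $\pi$; $\operatorname{Av}_{\mathcal{C}}(\pi)=\mathcal{C}\cap\operatorname{Av}(\pi)$. Two classes are Wilf-equivalent if they have the same number of permutations of each size. For permutations $\pi$ (size $n$) and $\tau$, $\pi\oplus\tau$ is $\pi$ followed by $\tau$ with all entries increased by $n$. Every permutation in $\operatorname{Av}(312,321)$ is uniquely a $\oplus$-sum of permutations of the forms $a^i = 12\cdots i$ ($i\ge1$) and $b_j = 23\cdots j1$ ($j\ge2$) with no two summands of the form $a^\cdot$ adjacent. Elements of $\mathcal{C}$ are identified with words over $\{a^i : i\ge1\}\cup\{b_j : j\ge 2\}$ with no two consecutive $a$-letters; juxtaposition of words corresponds to $\oplus$. 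-}

module Defs where

open import Data.Nat using (ℕ; zero; suc; _+_; _∸_; _≤_; _<ᵇ_; _≡ᵇ_)
open import Data.Bool using (Bool; true; false; _∧_; not; if_then_else_)
open import Data.List using (List; []; _∷_; _++_; map; length; upTo; concatMap; zip; cartesianProduct; [_])
open import Data.Bool.ListAction using (all; any)
open import Data.List.Relation.Unary.All using (All)
open import Data.Product using (_×_; _,_; proj₁; proj₂)
open import Data.Unit using (⊤)
open import Data.Empty using (⊥)
open import Relation.Binary.PropositionalEquality using (_≡_)

-- Permutations in one-line notation, 0-based: a permutation of size n is
-- a list containing each of 0,1,…,n-1 exactly once.

_==_ : Bool → Bool → Bool
true  == b = b
false == b = not b

orderIso : List ℕ → List ℕ → Bool
orderIso xs ys =
  (length xs ≡ᵇ length ys) ∧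
  all (λ pq → ((proj₁ (proj₁ pq) <ᵇ proj₁ (proj₂ pq)) == (proj₂ (proj₁ pq) <ᵇ proj₂ (proj₂ pq))))
      (cartesianProduct (zip xs ys) (zip xs ys))

subseqs : {A : Set} → List A → List (List A)
subseqs []       = [ [] ]
subseqs (x ∷ xs) = let r = subseqs xs in map (x ∷_) r ++ r

contains : List ℕ → List ℕ → Bool
contains π σ = any (orderIso π) (subseqs σ)

insertions : {A : Set} → A → List A → List (List A)
insertions x []       = [ x ∷ [] ]
insertions x (y ∷ ys) = (x ∷ y ∷ ys) ∷ map (y ∷_) (insertions x ys)

perms : ℕ → List (List ℕ)
perms zero    = [ [] ]
perms (suc n) = concatMap (insertions n) (perms n)

count : {A : Set} → (A → Bool) → List A → ℕ
count p []       = 0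
count p (x ∷ xs) = if p x then suc (count p xs) else count p xs

-- membership in 𝒞 = Av(312, 321)   (0-based: 312 = 201, 321 = 210)
inC : List ℕ → Bool
inC σ = not (contains (2 ∷ 0 ∷ 1 ∷ []) σ) ∧ not (contains (2 ∷ 1 ∷ 0 ∷ []) σ)

avCount : List ℕ → ℕ → ℕ
avCount π n = count (λ σ → inC σ ∧ not (contains π σ)) (perms n)

WilfEq : List ℕ → List ℕ → Set
WilfEq π τ = (n : ℕ) → avCount π n ≡ avCount τ n

-- a i stands for a^i = 12⋯i (i ≥ 1); b j stands for b_j = 23⋯j1 (j ≥ 2)
data Letter : Set where
  a : ℕ → Letter
  b : ℕ → Letter

Word : Set
Word = List Letter

ValidLetter : Letter → Set
ValidLetter (a i) = 1 ≤ i
ValidLetter (b j) = 2 ≤ j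

IsA : Letter → Set
IsA (a _) = ⊤
IsA (b _) = ⊥

NoAdjA : Word → Set
NoAdjA []           = ⊤
NoAdjA (x ∷ [])     = ⊤
NoAdjA (x ∷ y ∷ w)  = (IsA x → IsA y → ⊥) × NoAdjA (y ∷ w)

ValidWord : Word → Set
ValidWord w = All ValidLetter w × NoAdjA w

StartsWithA : Word → Set
StartsWithA []      = ⊥
StartsWithA (x ∷ _) = IsA x

_⊕_ : List ℕ → List ℕ → List ℕ
π ⊕ τ = π ++ map (length π +_) τ

letterPerm : Letter → List ℕ
letterPerm (a i) = upTo i
letterPerm (b j) = map suc (upTo (j ∸ 1)) ++ [ 0 ]

wordPerm : Word → List ℕ
wordPerm []      = []
wordPerm (x ∷ w) = letterPerm x ⊕ wordPerm w

-- Every permutation of 𝒞 is b_{c₁} ⊕ ⋯ ⊕ b_{cₖ} for a unique composition (c₁, …, cₖ), where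
-- b₁ = 1: a permutation lies outside 𝒞 exactly when some entry precedes two smaller ones, so a
-- new maximum can only be inserted at the end (a new part 1) or just before the last entry (the
-- last part grows). Hence |Av_𝒞(π) ∩ Sₙ| counts the compositions w of n with π ⋠ bsum w.
--
-- Let x be a^i or b_j (for a^i, α must not start with an a-letter). An occurrence of x ⊕ α in a
-- b-sum falls apart at a block boundary into an occurrence of x followed by one of α. Cutting each
-- composition after its shortest prefix containing x writes the number of compositions of |x| + m
-- avoiding x ⊕ α as a term independent of α plus Σ_{m′ ≤ m} P_{m,m′} · |Av_𝒞(α) ∩ S_{m′}|, where
-- P_{m,m} ≥ 1 because x itself is such a shortest prefix. This triangular system lets the counts
-- for α and for x ⊕ α determine each other.

module Submission where

open import Defs
open import Data.Nat using (_≤_)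
open import Data.List using (_∷_)
open import Data.Product using (_×_)
open import Relation.Nullary using (¬_)
open import Function.Bundles using (_⇔_)

open import Data.Bool using (Bool; true; false; T; not; _∧_; if_then_else_)
open import Data.Bool.Properties using (T-∧; T-≡; ⇔→≡)
open import Data.Empty using (⊥; ⊥-elim)
open import Data.Unit using (tt)
open import Data.Nat using (ℕ; zero; suc; _+_; _*_; _∸_; _<_; _<ᵇ_; _≡ᵇ_; z≤n; s≤s; z<s; s<s; >-nonZero)
open import Data.Nat.Properties
open import Data.Nat.ListAction using (sum)
open import Data.Nat.ListAction.Properties using (sum-++)
open import Data.List
  using (List; []; _++_; map; length; zip; cartesianProduct; [_]; upTo; applyUpTo; concatMap; replicate; initLast; _∷ʳ′_)
open import Data.List.Properties
  using (∷-injective; ∷-injectiveʳ; length-map; length-++; map-id; map-cong; map-cong-local; map-∘; map-++; ++-assoc; ++-identityʳ; zip-map)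
open import Data.List.Membership.Propositional using (_∈_; find; lose)
open import Data.List.Membership.Propositional.Properties
  using (∈-++⁺ˡ; ∈-++⁺ʳ; ∈-++⁻; ∈-map⁺; ∈-map⁻; ∈-concatMap⁻; ∈-cartesianProduct⁺; ∈-cartesianProduct⁻)
open import Data.List.Relation.Unary.Any using (here; there)
import Data.List.Relation.Unary.Any.Properties as Any
open import Data.List.Relation.Unary.All as All using (All; []; _∷_)
import Data.List.Relation.Unary.All.Properties as All
open import Data.List.Relation.Unary.Linked as Linked using (Linked; []; [-]; _∷_)
open import Data.List.Relation.Binary.Sublist.Propositional
  using (_⊆_; []; _∷_; _∷ʳ_; ⊆-refl; ⊆-trans; minimum; from∈) renaming (lookup to ⊆-lookup)
import Data.List.Relation.Binary.Sublist.Propositional.Properties as ⊆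
open import Data.Product using (∃₂; ∃-syntax; Σ-syntax; _,_; proj₁; proj₂; uncurry)
import Data.Product as Product
open import Data.Sum using (_⊎_; inj₁; inj₂; [_,_]′)
open import Function using (_∘_; id)
open import Function.Bundles using (mk⇔; Equivalence)
open import Relation.Binary.PropositionalEquality hiding ([_])
open import Relation.Binary using (tri<; tri≈; tri>)
open import Data.Nat.Induction using (<-rec)
open import Data.Nat.Solver using (module +-*-Solver)
open +-*-Solver using (solve; _:+_; _:*_; _:=_)

open Equivalence using (to; from)

T-injective : ∀ {x y} → (T x → T y) → (T y → T x) → x ≡ y
T-injective {false} {false} _ _ = refl
T-injective {false} {true}  _ g = ⊥-elim (g tt)
T-injective {true}  {false} f _ = ⊥-elim (f tt)
T-injective {true}  {true}  _ _ = refl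

true-or-false : ∀ x → x ≡ true ⊎ x ≡ false
true-or-false true  = inj₁ refl
true-or-false false = inj₂ refl

T-== : ∀ x y → T (x == y) ⇔ (T x ⇔ T y)
T-== true  true  = mk⇔ (λ _ → mk⇔ id id) (λ _ → tt)
T-== true  false = mk⇔ (λ ()) (λ e → to e tt)
T-== false true  = mk⇔ (λ ()) (λ e → from e tt)
T-== false false = mk⇔ (λ _ → mk⇔ id id) (λ _ → tt)

nor≡false⇔ : ∀ x y → (not x ∧ not y) ≡ false ⇔ (x ≡ true ⊎ y ≡ true)
nor≡false⇔ true  y     = mk⇔ (λ _ → inj₁ refl) (λ _ → refl)
nor≡false⇔ false true  = mk⇔ (λ _ → inj₂ refl) (λ _ → refl)
nor≡false⇔ false false = mk⇔ (λ ()) [ (λ ()) , (λ ()) ]′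

≡ᵇ-refl : ∀ n → (n ≡ᵇ n) ≡ true
≡ᵇ-refl n = to T-≡ (≡⇒≡ᵇ n n refl)

≡ᵇ-false : ∀ {m n} → m ≢ n → (m ≡ᵇ n) ≡ false
≡ᵇ-false {m} {n} m≢n = ⇔→≡ {z = true} (mk⇔ (λ e → ⊥-elim (m≢n (≡ᵇ⇒≡ m n (from T-≡ e)))) λ ())

χ : Bool → ℕ
χ x = if x then 1 else 0

-- Order isomorphism and pattern containment

Concordant : ℕ × ℕ → ℕ × ℕ → Set
Concordant (u , v) (t , w) = u < t ⇔ v < w

T-concordant : ∀ u v t w → T ((u <ᵇ t) == (v <ᵇ w)) ⇔ Concordant (u , v) (t , w)
T-concordant u v t w = mk⇔
  (λ e → let e′ = to (T-== _ _) e in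
     mk⇔ (λ u<t → <ᵇ⇒< v w (to e′ (<⇒<ᵇ u<t))) (λ v<w → <ᵇ⇒< u t (from e′ (<⇒<ᵇ v<w))))
  (λ c → from (T-== _ _)
     (mk⇔ (λ u<t → <⇒<ᵇ (to c (<ᵇ⇒< u t u<t))) (λ v<w → <⇒<ᵇ (from c (<ᵇ⇒< v w v<w)))))

concordant-refl : ∀ p → Concordant p p
concordant-refl (u , v) = mk⇔ (λ u<u → ⊥-elim (<-irrefl refl u<u)) (λ v<v → ⊥-elim (<-irrefl refl v<v))

concordant-< : ∀ {u v t w} → u < t → v < w → Concordant (u , v) (t , w)
concordant-< u<t v<w = mk⇔ (λ _ → v<w) (λ _ → u<t)

concordant-> : ∀ {u v t w} → t < u → w < v → Concordant (u , v) (t , w)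
concordant-> t<u w<v = mk⇔ (λ u<t → ⊥-elim (<-asym u<t t<u)) (λ v<w → ⊥-elim (<-asym v<w w<v))

AllConcordant : List (ℕ × ℕ) → Set
AllConcordant zs = ∀ {p q} → p ∈ zs → q ∈ zs → Concordant p q

allConcordant³ : ∀ {p q r} → Concordant p q → Concordant q p → Concordant p r → Concordant r p →
  Concordant q r → Concordant r q → AllConcordant (p ∷ q ∷ r ∷ [])
allConcordant³ {p} {q} {r} pq qp pr rp qr rq = go
  where
  go : AllConcordant (p ∷ q ∷ r ∷ [])
  go (here refl)                 (here refl)                 = concordant-refl p
  go (here refl)                 (there (here refl))         = pq
  go (here refl)                 (there (there (here refl))) = pr
  go (there (here refl))         (here refl)                 = qp
  go (there (here refl))         (there (here refl))         = concordant-refl q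
  go (there (here refl))         (there (there (here refl))) = qr
  go (there (there (here refl))) (here refl)                 = rp
  go (there (there (here refl))) (there (here refl))         = rq
  go (there (there (here refl))) (there (there (here refl))) = concordant-refl r

allConcordant-++ : ∀ {xs ys} → AllConcordant xs → AllConcordant ys →
  (∀ {u v t w} → (u , v) ∈ xs → (t , w) ∈ ys → u < t × v < w) → AllConcordant (xs ++ ys)
allConcordant-++ {xs} conc₁ conc₂ lower {u , v} {t , w} p∈ q∈ with ∈-++⁻ xs p∈ | ∈-++⁻ xs q∈
... | inj₁ p∈₁ | inj₁ q∈₁ = conc₁ p∈₁ q∈₁
... | inj₂ p∈₂ | inj₂ q∈₂ = conc₂ p∈₂ q∈₂
... | inj₁ p∈₁ | inj₂ q∈₂ = let u<t , v<w = lower p∈₁ q∈₂ in concordant-< u<t v<w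
... | inj₂ p∈₂ | inj₁ q∈₁ = let t<u , w<v = lower q∈₁ p∈₂ in concordant-> t<u w<v

concordantᵇ : (ℕ × ℕ) × (ℕ × ℕ) → Bool
concordantᵇ ((u , v) , (t , w)) = (u <ᵇ t) == (v <ᵇ w)

OrderIsomorphic : List ℕ → List ℕ → Set
OrderIsomorphic π s = length π ≡ length s × AllConcordant (zip π s)

orderIso⇔ : ∀ π s → T (orderIso π s) ⇔ OrderIsomorphic π s
orderIso⇔ π s = mk⇔
  (λ e → let len , pairs = to T-∧ e in
     ≡ᵇ⇒≡ _ _ len ,
     λ {(u , v)} {(t , w)} p∈ q∈ →
       to (T-concordant u v t w) (All.lookup (All.all⁺ concordantᵇ _ pairs) (∈-cartesianProduct⁺ p∈ q∈)))
  (λ (len , conc) → from T-∧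
     ( ≡⇒≡ᵇ _ _ len
     , All.all⁻ concordantᵇ {cartesianProduct (zip π s) (zip π s)} (All.tabulate λ {((u , v) , (t , w))} pq∈ →
         let p∈ , q∈ = ∈-cartesianProduct⁻ (zip π s) (zip π s) pq∈ in
         from (T-concordant u v t w) (conc p∈ q∈))))

OrderEmbedding : (ℕ → ℕ) → Set
OrderEmbedding f = ∀ {u t} → f u < f t ⇔ u < t

+-orderEmbedding : ∀ k → OrderEmbedding (k +_)
+-orderEmbedding k = mk⇔ (+-cancelˡ-< k _ _) (+-monoʳ-< k)

id-orderEmbedding : OrderEmbedding id
id-orderEmbedding = mk⇔ id id

orderIsomorphic-map : ∀ {f g} → OrderEmbedding f → OrderEmbedding g → ∀ π s →
  OrderIsomorphic (map f π) (map g s) ⇔ OrderIsomorphic π s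
orderIsomorphic-map {f} {g} emb-f emb-g π s = mk⇔
  (λ (len , conc) →
     trans (sym (length-map f π)) (trans len (length-map g s)) ,
     λ p∈ q∈ → reflect (conc (∈-map-zip p∈) (∈-map-zip q∈)))
  (λ (len , conc) →
     trans (length-map f π) (trans len (sym (length-map g s))) ,
     λ p∈ q∈ → preserve p∈ q∈ conc)
  where
  ∈-map-zip : ∀ {u v} → (u , v) ∈ zip π s → (f u , g v) ∈ zip (map f π) (map g s)
  ∈-map-zip p∈ = subst ((_ , _) ∈_) (sym (zip-map f g π s)) (∈-map⁺ (Product.map f g) p∈)
  reflect : ∀ {u v t w} → Concordant (f u , g v) (f t , g w) → Concordant (u , v) (t , w)
  reflect c = mk⇔ (λ u<t → to emb-g (to c (from emb-f u<t))) (λ v<w → to emb-f (from c (from emb-g v<w)))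
  preserve : ∀ {p q} → p ∈ zip (map f π) (map g s) → q ∈ zip (map f π) (map g s) →
    AllConcordant (zip π s) → Concordant p q
  preserve p∈ q∈ conc
    with ∈-map⁻ (Product.map f g) (subst (_ ∈_) (zip-map f g π s) p∈)
       | ∈-map⁻ (Product.map f g) (subst (_ ∈_) (zip-map f g π s) q∈)
  ... | (u , v) , p′∈ , refl | (t , w) , q′∈ , refl = mk⇔
    (λ fu<ft → from emb-g (to (conc p′∈ q′∈) (to emb-f fu<ft)))
    (λ gv<gw → from emb-f (from (conc p′∈ q′∈) (to emb-g gv<gw)))

orderIsomorphic-mapˡ : ∀ {f} → OrderEmbedding f → ∀ π s → OrderIsomorphic (map f π) s ⇔ OrderIsomorphic π s
orderIsomorphic-mapˡ emb π s =
  subst (λ s′ → OrderIsomorphic (map _ π) s′ ⇔ OrderIsomorphic π s) (map-id s) (orderIsomorphic-map emb id-orderEmbedding π s)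

orderIsomorphic-mapʳ : ∀ {g} → OrderEmbedding g → ∀ π s → OrderIsomorphic π (map g s) ⇔ OrderIsomorphic π s
orderIsomorphic-mapʳ emb π s =
  subst (λ π′ → OrderIsomorphic π′ (map _ s) ⇔ OrderIsomorphic π s) (map-id π) (orderIsomorphic-map id-orderEmbedding emb π s)

infix 4 _≼_

record _≼_ (π σ : List ℕ) : Set where
  constructor ≼-intro
  field ≼-holds : T (contains π σ)

open _≼_

≼⇒contains≡true : ∀ {π σ} → π ≼ σ → contains π σ ≡ true
≼⇒contains≡true = to T-≡ ∘ ≼-holds

record Occurrence (π σ : List ℕ) : Set where
  constructor occurrence
  field
    {image}    : List ℕ
    image⊆     : image ⊆ σ
    isomorphic : OrderIsomorphic π image

∈-subseqs⁺ : ∀ {A : Set} {s σ : List A} → s ⊆ σ → s ∈ subseqs σ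
∈-subseqs⁺ [] = here refl
∈-subseqs⁺ (refl ∷ s⊆σ) = ∈-++⁺ˡ (∈-map⁺ (_ ∷_) (∈-subseqs⁺ s⊆σ))
∈-subseqs⁺ {σ = x ∷ σ} (x ∷ʳ s⊆σ) = ∈-++⁺ʳ (map (x ∷_) (subseqs σ)) (∈-subseqs⁺ s⊆σ)

∈-subseqs⁻ : ∀ {A : Set} {s : List A} σ → s ∈ subseqs σ → s ⊆ σ
∈-subseqs⁻ [] (here refl) = []
∈-subseqs⁻ (x ∷ σ) s∈ with ∈-++⁻ (map (x ∷_) (subseqs σ)) s∈
... | inj₂ s∈′ = x ∷ʳ ∈-subseqs⁻ σ s∈′
... | inj₁ s∈′ with ∈-map⁻ (x ∷_) s∈′
...   | _ , s∈″ , refl = refl ∷ ∈-subseqs⁻ σ s∈″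

≼⇒occurrence : ∀ π σ → π ≼ σ → Occurrence π σ
≼⇒occurrence π σ π≼σ =
  let s , s∈ , iso = find (Any.any⁻ (orderIso π) (subseqs σ) (≼-holds π≼σ)) in
  occurrence (∈-subseqs⁻ σ s∈) (to (orderIso⇔ π s) iso)

occurrence⇒≼ : ∀ {π σ} → Occurrence π σ → π ≼ σ
occurrence⇒≼ {π} (occurrence {s} s⊆σ iso) =
  ≼-intro (Any.any⁺ (orderIso π) (lose (∈-subseqs⁺ s⊆σ) (from (orderIso⇔ π s) iso)))

occurrence³ : ∀ {u v t σ} → u ∷ v ∷ t ∷ [] ≼ σ →
  ∃[ x ] ∃[ y ] ∃[ z ] (x ∷ y ∷ z ∷ [] ⊆ σ × AllConcordant ((u , x) ∷ (v , y) ∷ (t , z) ∷ []))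
occurrence³ {u} {v} {t} {σ} π≼ with ≼⇒occurrence (u ∷ v ∷ t ∷ []) σ π≼
... | occurrence {x ∷ y ∷ z ∷ []} s⊆ (_ , conc) = x , y , z , s⊆ , conc

≼-refl : ∀ π → π ≼ π
≼-refl π = occurrence⇒≼ (occurrence ⊆-refl (refl , diagonal))
  where
  ∈-zip-self : ∀ {u v} xs → (u , v) ∈ zip xs xs → u ≡ v
  ∈-zip-self (x ∷ xs) (here refl) = refl
  ∈-zip-self (x ∷ xs) (there p∈) = ∈-zip-self xs p∈
  diagonal : AllConcordant (zip π π)
  diagonal {u , v} {t , w} p∈ q∈ rewrite ∈-zip-self π p∈ | ∈-zip-self π q∈ = mk⇔ id id

≼-⊆-trans : ∀ {π σ τ} → π ≼ σ → σ ⊆ τ → π ≼ τ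
≼-⊆-trans {π} {σ} π≼σ σ⊆τ with ≼⇒occurrence π σ π≼σ
... | occurrence s⊆σ iso = occurrence⇒≼ (occurrence (⊆-trans s⊆σ σ⊆τ) iso)

⊆-zip : ∀ {ρ π : List ℕ} s → ρ ⊆ π → length π ≡ length s →
  Σ[ r ∈ List ℕ ] (r ⊆ s × length ρ ≡ length r × (∀ {p} → p ∈ zip ρ r → p ∈ zip π s))
⊆-zip [] [] _ = [] , [] , refl , λ ()
⊆-zip (y ∷ s) (refl ∷ ρ⊆π) len with ⊆-zip s ρ⊆π (suc-injective len)
... | r , r⊆s , len′ , zip⊆ =
  y ∷ r , refl ∷ r⊆s , cong suc len′ , λ { (here refl) → here refl ; (there p∈) → there (zip⊆ p∈) }
⊆-zip (y ∷ s) (_ ∷ʳ ρ⊆π) len with ⊆-zip s ρ⊆π (suc-injective len)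
... | r , r⊆s , len′ , zip⊆ = r , y ∷ʳ r⊆s , len′ , there ∘ zip⊆

⊆-≼-trans : ∀ {ρ π σ} → ρ ⊆ π → π ≼ σ → ρ ≼ σ
⊆-≼-trans {ρ} {π} {σ} ρ⊆π π≼σ =
  let occurrence {s} s⊆σ (len , conc) = ≼⇒occurrence π σ π≼σ
      r , r⊆s , len′ , zip⊆ = ⊆-zip s ρ⊆π len
  in occurrence⇒≼ (occurrence (⊆-trans r⊆s s⊆σ) (len′ , λ p∈ q∈ → conc (zip⊆ p∈) (zip⊆ q∈)))

[]≼ : ∀ σ → [] ≼ σ
[]≼ σ = occurrence⇒≼ (occurrence (minimum σ) (refl , λ ()))

≼[]⇒≡[] : ∀ π → π ≼ [] → π ≡ []
≼[]⇒≡[] [] _ = refl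
≼[]⇒≡[] (u ∷ π) π≼[] with ≼⇒occurrence (u ∷ π) [] π≼[]
... | occurrence [] (() , _)

≼⇒length≤ : ∀ π σ → π ≼ σ → length π ≤ length σ
≼⇒length≤ π σ π≼σ with ≼⇒occurrence π σ π≼σ
... | occurrence s⊆σ (len , _) = subst (_≤ length σ) (sym len) (⊆.length-mono-≤ s⊆σ)

⊆-map⁻ : ∀ (f : ℕ → ℕ) {s} σ → s ⊆ map f σ → ∃[ s′ ] (s ≡ map f s′ × s′ ⊆ σ)
⊆-map⁻ f [] [] = [] , refl , []
⊆-map⁻ f (x ∷ σ) (refl ∷ s⊆) with ⊆-map⁻ f σ s⊆
... | s′ , refl , s′⊆ = x ∷ s′ , refl , refl ∷ s′⊆
⊆-map⁻ f (x ∷ σ) (_ ∷ʳ s⊆) with ⊆-map⁻ f σ s⊆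
... | s′ , refl , s′⊆ = s′ , refl , x ∷ʳ s′⊆

≼-mapʳ : ∀ {f} → OrderEmbedding f → ∀ π σ → π ≼ map f σ ⇔ π ≼ σ
≼-mapʳ {f} emb π σ = mk⇔ unmap remap
  where
  unmap : π ≼ map f σ → π ≼ σ
  unmap π≼ with ≼⇒occurrence π (map f σ) π≼
  ... | occurrence s⊆ iso with ⊆-map⁻ f σ s⊆
  ...   | s′ , refl , s′⊆ = occurrence⇒≼ (occurrence s′⊆ (to (orderIsomorphic-mapʳ emb π s′) iso))
  remap : π ≼ σ → π ≼ map f σ
  remap π≼ with ≼⇒occurrence π σ π≼
  ... | occurrence {s} s⊆ iso = occurrence⇒≼ (occurrence (⊆.map⁺ f s⊆) (from (orderIsomorphic-mapʳ emb π s) iso))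

≼-mapˡ : ∀ {f} → OrderEmbedding f → ∀ π σ → map f π ≼ σ ⇔ π ≼ σ
≼-mapˡ {f} emb π σ = mk⇔ unmap remap
  where
  unmap : map f π ≼ σ → π ≼ σ
  unmap π≼ with ≼⇒occurrence (map f π) σ π≼
  ... | occurrence {s} s⊆ iso = occurrence⇒≼ (occurrence s⊆ (to (orderIsomorphic-mapˡ emb π s) iso))
  remap : π ≼ σ → map f π ≼ σ
  remap π≼ with ≼⇒occurrence π σ π≼
  ... | occurrence {s} s⊆ iso = occurrence⇒≼ (occurrence s⊆ (from (orderIsomorphic-mapˡ emb π s) iso))

-- Direct sums

Bounded : List ℕ → Set
Bounded σ = All (_< length σ) σ

Below : List ℕ → List ℕ → Set
Below π₁ π₂ = ∀ {u t} → u ∈ π₁ → t ∈ π₂ → u < t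

length-⊕ : ∀ π τ → length (π ⊕ τ) ≡ length π + length τ
length-⊕ π τ = trans (length-++ π) (cong (length π +_) (length-map _ τ))

⊕-identityˡ : ∀ π → [] ⊕ π ≡ π
⊕-identityˡ = map-id

⊕-identityʳ : ∀ π → π ⊕ [] ≡ π
⊕-identityʳ = ++-identityʳ

⊕-assoc : ∀ π τ ρ → (π ⊕ τ) ⊕ ρ ≡ π ⊕ (τ ⊕ ρ)
⊕-assoc π τ ρ = begin
  (π ++ map (length π +_) τ) ++ map (length (π ⊕ τ) +_) ρ
    ≡⟨ ++-assoc π _ _ ⟩
  π ++ (map (length π +_) τ ++ map (length (π ⊕ τ) +_) ρ)
    ≡⟨ cong (λ ρ′ → π ++ (map (length π +_) τ ++ ρ′)) shifted ⟩
  π ++ (map (length π +_) τ ++ map (length π +_) (map (length τ +_) ρ))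
    ≡⟨ cong (π ++_) (map-++ (length π +_) τ _) ⟨
  π ⊕ (τ ⊕ ρ) ∎
  where
  open ≡-Reasoning
  shifted : map (length (π ⊕ τ) +_) ρ ≡ map (length π +_) (map (length τ +_) ρ)
  shifted = begin
    map (length (π ⊕ τ) +_) ρ                   ≡⟨ cong (λ k → map (k +_) ρ) (length-⊕ π τ) ⟩
    map (length π + length τ +_) ρ              ≡⟨ map-cong (+-assoc (length π) (length τ)) ρ ⟩
    map ((length π +_) ∘ (length τ +_)) ρ       ≡⟨ map-∘ ρ ⟩
    map (length π +_) (map (length τ +_) ρ)     ∎

∈-shifted⇒≤ : ∀ {k v} σ → v ∈ map (k +_) σ → k ≤ v
∈-shifted⇒≤ {k} σ v∈ with ∈-map⁻ (k +_) v∈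
... | w , _ , refl = m≤m+n k w

⊕-bounded : ∀ {π τ} → Bounded π → Bounded τ → Bounded (π ⊕ τ)
⊕-bounded {π} {τ} bπ bτ = subst (λ n → All (_< n) (π ⊕ τ)) (sym (length-⊕ π τ))
  (All.++⁺ (All.map (λ v<π → <-≤-trans v<π (m≤m+n (length π) (length τ))) bπ)
           (All.map⁺ (All.map (+-monoʳ-< (length π)) bτ)))

≼-⊕ʳ : ∀ {π σ₂} σ₁ → π ≼ σ₂ → π ≼ σ₁ ⊕ σ₂
≼-⊕ʳ {π} {σ₂} σ₁ π≼ =
  ≼-⊆-trans (from (≼-mapʳ (+-orderEmbedding (length σ₁)) π σ₂) π≼) (⊆.++⁺ˡ σ₁ ⊆-refl)

⊆-++⁻ : ∀ {s : List ℕ} σ₁ σ₂ → s ⊆ σ₁ ++ σ₂ →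
  ∃₂ λ s₁ s₂ → s ≡ s₁ ++ s₂ × s₁ ⊆ σ₁ × s₂ ⊆ σ₂
⊆-++⁻ [] σ₂ s⊆ = [] , _ , refl , [] , s⊆
⊆-++⁻ (x ∷ σ₁) σ₂ (refl ∷ s⊆) with ⊆-++⁻ σ₁ σ₂ s⊆
... | s₁ , s₂ , refl , s₁⊆ , s₂⊆ = x ∷ s₁ , s₂ , refl , refl ∷ s₁⊆ , s₂⊆
⊆-++⁻ (x ∷ σ₁) σ₂ (_ ∷ʳ s⊆) with ⊆-++⁻ σ₁ σ₂ s⊆
... | s₁ , s₂ , refl , s₁⊆ , s₂⊆ = s₁ , s₂ , refl , x ∷ʳ s₁⊆ , s₂⊆

zip-++ : ∀ (xs zs : List ℕ) {ys ws : List ℕ} → length xs ≡ length zs →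
  zip (xs ++ ys) (zs ++ ws) ≡ zip xs zs ++ zip ys ws
zip-++ [] [] _ = refl
zip-++ (x ∷ xs) (z ∷ zs) len = cong ((x , z) ∷_) (zip-++ xs zs (suc-injective len))

∈-zip⁻ : ∀ {u v : ℕ} π s → (u , v) ∈ zip π s → u ∈ π × v ∈ s
∈-zip⁻ (x ∷ π) (y ∷ s) (here refl) = here refl , here refl
∈-zip⁻ (x ∷ π) (y ∷ s) (there p∈) = Product.map there there (∈-zip⁻ π s p∈)

∈-zip-partner : ∀ {u : ℕ} π (s : List ℕ) → length π ≡ length s → u ∈ π → ∃[ v ] ((u , v) ∈ zip π s)
∈-zip-partner (x ∷ π) (y ∷ s) _ (here refl) = y , here refl
∈-zip-partner (x ∷ π) (y ∷ s) len (there u∈) = Product.map₂ there (∈-zip-partner π s (suc-injective len) u∈)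

splitAt-length : ∀ (π s₁ s₂ : List ℕ) → length π ≡ length (s₁ ++ s₂) →
  ∃₂ λ π₁ π₂ → π ≡ π₁ ++ π₂ × length π₁ ≡ length s₁ × length π₂ ≡ length s₂
splitAt-length π [] s₂ len = [] , π , refl , refl , len
splitAt-length (x ∷ π) (_ ∷ s₁) s₂ len with splitAt-length π s₁ s₂ (suc-injective len)
... | π₁ , π₂ , refl , len₁ , len₂ = x ∷ π₁ , π₂ , refl , cong suc len₁ , len₂

≼-⊕⁻ : ∀ π σ₁ σ₂ → Bounded σ₁ → π ≼ σ₁ ⊕ σ₂ →
  ∃₂ λ π₁ π₂ → π ≡ π₁ ++ π₂ × Below π₁ π₂ × π₁ ≼ σ₁ × π₂ ≼ σ₂
≼-⊕⁻ π σ₁ σ₂ bσ₁ π≼ with ≼⇒occurrence π (σ₁ ⊕ σ₂) π≼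
... | occurrence s⊆ (len , conc) with ⊆-++⁻ σ₁ (map (length σ₁ +_) σ₂) s⊆
... | s₁ , s₂ , refl , s₁⊆ , s₂⊆ with ⊆-map⁻ (length σ₁ +_) σ₂ s₂⊆
... | s₂′ , refl , s₂′⊆ with splitAt-length π s₁ (map (length σ₁ +_) s₂′) len
... | π₁ , π₂ , refl , len₁ , len₂ =
  π₁ , π₂ , refl , below ,
  occurrence⇒≼ (occurrence s₁⊆ (len₁ , λ p∈ q∈ → conc (inˡ p∈) (inˡ q∈))) ,
  to (≼-mapʳ (+-orderEmbedding k) π₂ σ₂)
    (occurrence⇒≼ (occurrence (⊆.map⁺ (k +_) s₂′⊆) (len₂ , λ p∈ q∈ → conc (inʳ p∈) (inʳ q∈))))
  where
  k = length σ₁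
  zip≡ = zip-++ π₁ s₁ {π₂} {map (k +_) s₂′} len₁
  inˡ : ∀ {p} → p ∈ zip π₁ s₁ → p ∈ zip (π₁ ++ π₂) (s₁ ++ map (k +_) s₂′)
  inˡ p∈ = subst (_ ∈_) (sym zip≡) (∈-++⁺ˡ p∈)
  inʳ : ∀ {p} → p ∈ zip π₂ (map (k +_) s₂′) → p ∈ zip (π₁ ++ π₂) (s₁ ++ map (k +_) s₂′)
  inʳ p∈ = subst (_ ∈_) (sym zip≡) (∈-++⁺ʳ (zip π₁ s₁) p∈)
  below : Below π₁ π₂
  below u∈ t∈ with ∈-zip-partner π₁ s₁ len₁ u∈ | ∈-zip-partner π₂ (map (k +_) s₂′) len₂ t∈
  ... | v , uv∈ | w , tw∈ = from (conc (inˡ uv∈) (inʳ tw∈))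
    (<-≤-trans (All.lookup bσ₁ (⊆-lookup s₁⊆ (proj₂ (∈-zip⁻ π₁ s₁ uv∈))))
               (∈-shifted⇒≤ s₂′ (proj₂ (∈-zip⁻ π₂ _ tw∈))))

≼-⊕⁺ : ∀ {π₁ π₂ σ₁ σ₂} → Bounded σ₁ → Below π₁ π₂ → π₁ ≼ σ₁ → π₂ ≼ σ₂ →
  π₁ ++ π₂ ≼ σ₁ ⊕ σ₂
≼-⊕⁺ {π₁} {π₂} {σ₁} {σ₂} bσ₁ below π₁≼ π₂≼ =
  let occurrence {s₁} s₁⊆ (len₁ , conc₁) = ≼⇒occurrence π₁ σ₁ π₁≼
      occurrence {s₂} s₂⊆ (len₂ , conc₂) = ≼⇒occurrence π₂ (map (length σ₁ +_) σ₂)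
                                             (from (≼-mapʳ (+-orderEmbedding (length σ₁)) π₂ σ₂) π₂≼)
      lower : ∀ {u v t w} → (u , v) ∈ zip π₁ s₁ → (t , w) ∈ zip π₂ s₂ → u < t × v < w
      lower p∈ q∈ = let u∈ , v∈ = ∈-zip⁻ π₁ s₁ p∈
                        t∈ , w∈ = ∈-zip⁻ π₂ s₂ q∈
                    in below u∈ t∈ ,
                       <-≤-trans (All.lookup bσ₁ (⊆-lookup s₁⊆ v∈)) (∈-shifted⇒≤ σ₂ (⊆-lookup s₂⊆ w∈))
      zip≡ = zip-++ π₁ s₁ {π₂} {s₂} len₁
  in occurrence⇒≼ (occurrence (⊆.++⁺ s₁⊆ s₂⊆)
       (trans (length-++ π₁) (trans (cong₂ _+_ len₁ len₂) (sym (length-++ s₁))) ,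
        λ p∈ q∈ → allConcordant-++ conc₁ conc₂ lower (subst (_ ∈_) zip≡ p∈) (subst (_ ∈_) zip≡ q∈)))

-- Intervals and the permutations b_j

interval : ℕ → ℕ → List ℕ
interval s zero    = []
interval s (suc n) = s ∷ interval (suc s) n

length-interval : ∀ s n → length (interval s n) ≡ n
length-interval s zero    = refl
length-interval s (suc n) = cong suc (length-interval (suc s) n)

applyUpTo≡interval : ∀ (f : ℕ → ℕ) s n → (∀ x → f x ≡ s + x) → applyUpTo f n ≡ interval s n
applyUpTo≡interval f s zero    f≗ = refl
applyUpTo≡interval f s (suc n) f≗ = cong₂ _∷_ (trans (f≗ 0) (+-identityʳ s))
  (applyUpTo≡interval (f ∘ suc) (suc s) n (λ x → trans (f≗ (suc x)) (+-suc s x)))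

upTo≡interval : ∀ n → upTo n ≡ interval 0 n
upTo≡interval n = applyUpTo≡interval id 0 n (λ _ → refl)

map-interval : ∀ k s n → map (k +_) (interval s n) ≡ interval (k + s) n
map-interval k s zero    = refl
map-interval k s (suc n) = cong (k + s ∷_) (trans (map-interval k (suc s) n) (cong (λ s′ → interval s′ n) (+-suc k s)))

interval-++ : ∀ s m n → interval s (m + n) ≡ interval s m ++ interval (s + m) n
interval-++ s zero    n = cong (λ s′ → interval s′ n) (sym (+-identityʳ s))
interval-++ s (suc m) n = cong (s ∷_) (trans (interval-++ (suc s) m n)
  (cong (λ s′ → interval (suc s) m ++ interval s′ n) (sym (+-suc s m))))

interval-++⁻ : ∀ s n (π₁ zs : List ℕ) → interval s n ≡ π₁ ++ zs →
  π₁ ≡ interval s (length π₁) × zs ≡ interval (s + length π₁) (length zs) × n ≡ length π₁ + length zs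
interval-++⁻ s n [] _ refl = refl , cong₂ interval (sym (+-identityʳ s)) (sym (length-interval s n))
                           , sym (length-interval s n)
interval-++⁻ s (suc n) (u ∷ π₁) zs eq with ∷-injective eq
... | refl , eq′ with interval-++⁻ (suc s) n π₁ zs eq′
...   | π₁≡ , zs≡ , n≡ =
  cong (s ∷_) π₁≡ , trans zs≡ (cong (λ s′ → interval s′ (length zs)) (sym (+-suc s (length π₁)))) , cong suc n≡

∈-interval⁻ : ∀ {v} s n → v ∈ interval s n → s ≤ v × v < s + n
∈-interval⁻ s (suc n) (here refl) = ≤-refl , m<m+n s z<s
∈-interval⁻ {v} s (suc n) (there v∈) with ∈-interval⁻ (suc s) n v∈
... | s<v , v<s+n = <⇒≤ s<v , subst (v <_) (sym (+-suc s n)) v<s+n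

interval-bounded : ∀ n → Bounded (interval 0 n)
interval-bounded n = subst (λ m → All (_< m) (interval 0 n)) (sym (length-interval 0 n))
  (All.tabulate (proj₂ ∘ ∈-interval⁻ 0 n))

interval-increasing : ∀ {p q r} s n → p ∷ q ∷ r ⊆ interval s n → p < q
interval-increasing s (suc n) (refl ∷ s⊆) = proj₁ (∈-interval⁻ (suc s) n (⊆-lookup s⊆ (here refl)))
interval-increasing s (suc n) (_ ∷ʳ s⊆) = interval-increasing (suc s) n s⊆

block : ℕ → List ℕ
block c = letterPerm (b c)

block-shape : ∀ c → block c ≡ interval 1 (c ∸ 1) ++ [ 0 ]
block-shape c = trans (cong (λ xs → map suc xs ++ [ 0 ]) (upTo≡interval (c ∸ 1))) (cong (_++ [ 0 ]) (map-interval 1 0 (c ∸ 1)))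

length-block : ∀ c → length (block c) ≡ suc (c ∸ 1)
length-block c = begin
  length (block c)                                ≡⟨ cong length (block-shape c) ⟩
  length (interval 1 (c ∸ 1) ++ [ 0 ])            ≡⟨ length-++ (interval 1 (c ∸ 1)) ⟩
  length (interval 1 (c ∸ 1)) + 1                 ≡⟨ cong (_+ 1) (length-interval 1 (c ∸ 1)) ⟩
  (c ∸ 1) + 1                                     ≡⟨ +-comm (c ∸ 1) 1 ⟩
  suc (c ∸ 1)                                     ∎
  where open ≡-Reasoning

block-bounded : ∀ c → Bounded (block c)
block-bounded c = subst (λ n → All (_< n) (block c)) (sym (length-block c))
  (subst (All (_< suc (c ∸ 1))) (sym (block-shape c))
    (All.++⁺ (All.tabulate (proj₂ ∘ ∈-interval⁻ 1 (c ∸ 1))) (z<s ∷ [])))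

⊆-[x]⁻ : ∀ {s : List ℕ} {x} → s ⊆ [ x ] → s ≡ [] ⊎ s ≡ [ x ]
⊆-[x]⁻ (_ ∷ʳ []) = inj₁ refl
⊆-[x]⁻ (refl ∷ []) = inj₂ refl

block-descent : ∀ {p q r} c → p ∷ q ∷ r ⊆ block c → q < p → q ≡ 0 × r ≡ []
block-descent {p} {q} {r} c s⊆ q<p
  with ⊆-++⁻ (interval 1 (c ∸ 1)) [ 0 ] (subst (p ∷ q ∷ r ⊆_) (block-shape c) s⊆)
... | [] , s₂ , refl , _ , s₂⊆ with ⊆-[x]⁻ s₂⊆
...   | inj₁ ()
...   | inj₂ ()
block-descent c s⊆ q<p | _ ∷ [] , s₂ , refl , _ , s₂⊆ with ⊆-[x]⁻ s₂⊆
...   | inj₁ ()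
...   | inj₂ refl = refl , refl
block-descent c s⊆ q<p | _ ∷ _ ∷ _ , s₂ , refl , s₁⊆ , _ =
  ⊥-elim (<-asym q<p (interval-increasing 1 (c ∸ 1) s₁⊆))

block-avoids-inner-descent : ∀ c {u v t} → u ∷ v ∷ t ∷ [] ≼ block c → v < u → ⊥
block-avoids-inner-descent c π≼ v<u with occurrence³ π≼
... | x , y , z , s⊆ , conc with block-descent c s⊆ (to (conc (there (here refl)) (here refl)) v<u)
...   | _ , ()

block-avoids-132 : ∀ c {u v t} → u ∷ v ∷ t ∷ [] ≼ block c → u < t → t < v → ⊥
block-avoids-132 c π≼ u<t t<v with occurrence³ π≼
... | x , y , z , s⊆ , conc
  with block-descent c (⊆.∷ˡ⁻ s⊆) (to (conc (there (there (here refl))) (there (here refl))) t<v)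
...   | refl , _ = n≮0 (to (conc (here refl) (there (there (here refl)))) u<t)

-- letterPerm (b 1) is the permutation 1, so compositions (all parts ≥ 1) encode all of 𝒞.
bsum : List ℕ → List ℕ
bsum w = wordPerm (map b w)

bsum-++ : ∀ w₁ w₂ → bsum (w₁ ++ w₂) ≡ bsum w₁ ⊕ bsum w₂
bsum-++ [] w₂ = sym (⊕-identityˡ (bsum w₂))
bsum-++ (c ∷ w₁) w₂ = trans (cong (block c ⊕_) (bsum-++ w₁ w₂)) (sym (⊕-assoc (block c) (bsum w₁) (bsum w₂)))

bsum-bounded : ∀ w → Bounded (bsum w)
bsum-bounded [] = []
bsum-bounded (c ∷ w) = ⊕-bounded (block-bounded c) (bsum-bounded w)

length-bsum-∷ : ∀ c w → length (bsum (c ∷ w)) ≡ suc (c ∸ 1) + length (bsum w)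
length-bsum-∷ c w = trans (length-⊕ (block c) (bsum w)) (cong (_+ length (bsum w)) (length-block c))

length-bsum-snoc : ∀ p c → 1 ≤ c → length (bsum (p ++ [ c ])) ≡ length (bsum p) + c
length-bsum-snoc p (suc c) _ = begin
  length (bsum (p ++ [ suc c ]))            ≡⟨ cong length (bsum-++ p [ suc c ]) ⟩
  length (bsum p ⊕ bsum [ suc c ])          ≡⟨ length-⊕ (bsum p) _ ⟩
  length (bsum p) + length (bsum [ suc c ]) ≡⟨ cong (length (bsum p) +_) (trans (length-bsum-∷ (suc c) []) (+-identityʳ _)) ⟩
  length (bsum p) + suc c                   ∎
  where open ≡-Reasoning

bsum-++[1] : ∀ w → bsum (w ++ [ 1 ]) ≡ bsum w ++ [ length (bsum w) ]
bsum-++[1] w = trans (bsum-++ w [ 1 ]) (cong (λ k → bsum w ++ [ k ]) (+-identityʳ _))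

replicate-snoc : ∀ d (v : ℕ) → replicate d v ++ [ v ] ≡ replicate (suc d) v
replicate-snoc zero    v = refl
replicate-snoc (suc d) v = cong (v ∷_) (replicate-snoc d v)

bsum-replicate : ∀ d → bsum (replicate d 1) ≡ interval 0 d
bsum-replicate zero    = refl
bsum-replicate (suc d) = cong (0 ∷_) (trans (cong (map (1 +_)) (bsum-replicate d)) (map-interval 1 0 d))

-- Splitting an occurrence of x ⊕ α along a composition

Splits : List ℕ → List ℕ → List ℕ → Set
Splits x α w = ∃₂ λ w₁ w₂ → w ≡ w₁ ++ w₂ × x ≼ bsum w₁ × α ≼ bsum w₂

Splittable : List ℕ → List ℕ → Set
Splittable x α = ∀ w → x ⊕ α ≼ bsum w → Splits x α w

splits-∷ : ∀ {x α w} c → Splits x α w → Splits x α (c ∷ w)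
splits-∷ {x} c (w₁ , w₂ , refl , x≼ , α≼) = c ∷ w₁ , w₂ , refl , ≼-⊕ʳ (block c) x≼ , α≼

splits⇒≼ : ∀ {x} α → Bounded x → ∀ {w} → Splits x α w → x ⊕ α ≼ bsum w
splits⇒≼ {x} α bx (w₁ , w₂ , refl , x≼ , α≼) =
  subst (x ⊕ α ≼_) (sym (bsum-++ w₁ w₂))
    (≼-⊕⁺ (bsum-bounded w₁) (λ u∈ t∈ → <-≤-trans (All.lookup bx u∈) (∈-shifted⇒≤ α t∈))
      x≼ (from (≼-mapˡ (+-orderEmbedding (length x)) α (bsum w₂)) α≼))

++-meet : ∀ (xs ys π₁ π₂ : List ℕ) → xs ++ ys ≡ π₁ ++ π₂ →
  (∃₂ λ z zs → π₁ ≡ xs ++ z ∷ zs × ys ≡ z ∷ zs ++ π₂) ⊎ (∃[ zs ] (xs ≡ π₁ ++ zs × π₂ ≡ zs ++ ys))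
++-meet [] ys [] π₂ eq = inj₂ ([] , refl , sym eq)
++-meet [] ys (z ∷ π₁) π₂ eq = inj₁ (z , π₁ , refl , eq)
++-meet (x ∷ xs) ys [] π₂ eq = inj₂ (x ∷ xs , refl , sym eq)
++-meet (x ∷ xs) ys (p ∷ π₁) π₂ eq with ∷-injective eq
... | refl , eq′ with ++-meet xs ys π₁ π₂ eq′
...   | inj₁ (z , zs , refl , e) = inj₁ (z , zs , refl , e)
...   | inj₂ (zs , refl , e) = inj₂ (zs , refl , e)

last∈suffix : ∀ (xs : List ℕ) z ys y zs → xs ++ [ z ] ≡ ys ++ y ∷ zs → z ∈ y ∷ zs
last∈suffix xs z [] y zs eq = subst (z ∈_) eq (∈-++⁺ʳ xs (here refl))
last∈suffix [] z (_ ∷ []) y zs ()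
last∈suffix [] z (_ ∷ _ ∷ _) y zs ()
last∈suffix (x ∷ xs) z (_ ∷ ys) y zs eq = last∈suffix xs z ys y zs (∷-injectiveʳ eq)

splits-at-head : ∀ {x α c w} → x ≼ block c → map (length x +_) α ≼ bsum w → Splits x α (c ∷ w)
splits-at-head {x} {α} {c} {w} x≼ α≼ =
  [ c ] , w , refl , subst (x ≼_) (sym (⊕-identityʳ (block c))) x≼ ,
  to (≼-mapˡ (+-orderEmbedding (length x)) α (bsum w)) α≼

-- An occurrence of b_j ⊕ α cannot let α begin inside the block holding the final 1 of b_j
-- (a descent inside some b_c is always its last step), nor split b_j between blocks (its 1
-- would lie above its 2).
b-splittable : ∀ k α → Splittable (block (2 + k)) α
b-splittable k α [] x⊕α≼ with ≼[]⇒≡[] _ x⊕α≼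
... | ()
b-splittable k α (c ∷ w) x⊕α≼ with ≼-⊕⁻ _ (block c) (bsum w) (block-bounded c) x⊕α≼
... | π₁ , π₂ , eq , below , π₁≼ , π₂≼ with ++-meet x (map (length x +_) α) π₁ π₂ eq
  where x = block (2 + k)
... | inj₁ (z , zs , refl , _) =
  ⊥-elim (block-avoids-inner-descent c (⊆-≼-trans inner-descent π₁≼) z<s)
  where
  inner-descent : 1 ∷ 0 ∷ z ∷ [] ⊆ block (2 + k) ++ z ∷ zs
  inner-descent = subst (λ x → 1 ∷ 0 ∷ z ∷ [] ⊆ x ++ z ∷ zs) (sym (block-shape (2 + k)))
    (refl ∷ subst (0 ∷ z ∷ [] ⊆_) (sym (++-assoc (interval 2 k) [ 0 ] (z ∷ zs)))
                 (⊆.++⁺ˡ (interval 2 k) (refl ∷ refl ∷ minimum zs)))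
... | inj₂ (zs , x≡ , refl) with π₁ | zs
...   | [] | _ = splits-∷ c (b-splittable k α w
                    (subst (λ y → y ++ map (length (block (2 + k)) +_) α ≼ bsum w) (sym x≡) π₂≼))
...   | p ∷ π₁′ | [] = splits-at-head (subst (_≼ block c) (trans (sym (++-identityʳ _)) (sym x≡)) π₁≼) π₂≼
...   | p ∷ π₁′ | z ∷ zs′ = ⊥-elim (n≮0 (below (here refl) (∈-++⁺ˡ 0∈zs)))
  where
  0∈zs : 0 ∈ z ∷ zs′
  0∈zs = last∈suffix (interval 1 (suc k)) 0 (p ∷ π₁′) z zs′ (trans (sym (block-shape (2 + k))) x≡)

interval-⊕ : ∀ n α → interval 0 n ⊕ α ≡ interval 0 n ++ map (n +_) α
interval-⊕ n α = cong (λ m → interval 0 n ++ map (m +_) α) (length-interval 0 n)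

interval-shift : ∀ k d α → interval k d ++ map ((k + d) +_) α ≡ map (k +_) (interval 0 d ++ map (d +_) α)
interval-shift k d α = sym (begin
  map (k +_) (interval 0 d ++ map (d +_) α)              ≡⟨ map-++ (k +_) (interval 0 d) _ ⟩
  map (k +_) (interval 0 d) ++ map (k +_) (map (d +_) α) ≡⟨ cong₂ _++_ (trans (map-interval k 0 d) (cong (λ s → interval s d) (+-identityʳ k)))
                                                                       (sym (trans (map-cong (+-assoc k d) α) (map-∘ α))) ⟩
  interval k d ++ map ((k + d) +_) α                     ∎)
  where open ≡-Reasoning

≼-interval-⊕ : ∀ {σ₁ σ₂} k d → Bounded σ₁ → interval 0 k ≼ σ₁ → interval 0 d ≼ σ₂ →
  interval 0 (k + d) ≼ σ₁ ⊕ σ₂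
≼-interval-⊕ {σ₁} {σ₂} k d bσ₁ k≼ d≼ =
  subst (_≼ σ₁ ⊕ σ₂) (sym split)
    (≼-⊕⁺ bσ₁ (λ u∈ t∈ → <-≤-trans (proj₂ (∈-interval⁻ 0 k u∈)) (∈-shifted⇒≤ (interval 0 d) t∈))
      k≼ (from (≼-mapˡ (+-orderEmbedding k) (interval 0 d) σ₂) d≼))
  where
  split : interval 0 (k + d) ≡ interval 0 k ++ map (k +_) (interval 0 d)
  split = trans (interval-++ 0 k d) (cong (interval 0 k ++_) (sym (trans (map-interval k 0 d) (cong (λ s → interval s d) (+-identityʳ k)))))

interval-splits-∷ : ∀ α c w k d → (∀ d′ → interval 0 d′ ⊕ α ≼ bsum w → Splits (interval 0 d′) α w) →
  interval 0 k ≼ block c → interval k d ++ map ((k + d) +_) α ≼ bsum w → Splits (interval 0 (k + d)) α (c ∷ w)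
interval-splits-∷ α c w k d splitsʷ k≼ rest≼ with splitsʷ d (subst (_≼ bsum w) (sym (interval-⊕ d α))
    (to (≼-mapˡ (+-orderEmbedding k) _ (bsum w)) (subst (_≼ bsum w) (interval-shift k d α) rest≼)))
... | w₁ , w₂ , refl , d≼ , α≼ = c ∷ w₁ , w₂ , refl , ≼-interval-⊕ k d (block-bounded c) k≼ d≼ , α≼

-- The shape of wordPerm A when A does not start with an a-letter.
EmptyOrStartsWithB : List ℕ → Set
EmptyOrStartsWithB α = α ≡ [] ⊎ ∃[ α′ ] (α ≡ 1 ∷ α′ × 0 ∈ α′)

-- If the first block of an occurrence of a^i ⊕ α reached into α, it would hold α's leading
-- entry but not the smaller entry after it (that would be a 132 inside some b_c), so that smaller
-- entry would lie in a later block, hence above it.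
a-splittable : ∀ α → EmptyOrStartsWithB α → ∀ i → Splittable (interval 0 i) α
a-splittable α hα zero w x⊕α≼ = [] , w , refl , []≼ [] , subst (_≼ bsum w) (map-id α) x⊕α≼
a-splittable α hα (suc i) [] x⊕α≼ with ≼[]⇒≡[] _ x⊕α≼
... | ()
a-splittable α hα (suc i) (c ∷ w) x⊕α≼
  with ≼-⊕⁻ _ (block c) (bsum w) (block-bounded c) (subst (_≼ block c ⊕ bsum w) (interval-⊕ (suc i) α) x⊕α≼)
... | π₁ , π₂ , eq , below , π₁≼ , π₂≼ with ++-meet (interval 0 (suc i)) (map (suc i +_) α) π₁ π₂ eq
... | inj₂ (zs , x≡ , refl) with interval-++⁻ 0 (suc i) π₁ zs x≡
...   | π₁≡ , zs≡ , i≡ = subst (λ n → Splits (interval 0 n) α (c ∷ w)) (sym i≡)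
        (interval-splits-∷ α c w (length π₁) (length zs) (λ d → a-splittable α hα d w)
          (subst (_≼ block c) π₁≡ π₁≼) (subst₂ (λ ys n → ys ++ map (n +_) α ≼ bsum w) zs≡ i≡ π₂≼))
a-splittable α (inj₁ refl) (suc i) (c ∷ w) x⊕α≼ | _ | inj₁ (_ , _ , _ , ())
a-splittable α (inj₂ (α′ , refl , 0∈α′)) (suc i) (c ∷ w) x⊕α≼
  | π₁ , π₂ , eq , below , π₁≼ , π₂≼ | inj₁ (z , zs , refl , α≡) with ∷-injective α≡
... | refl , α′≡ with ∈-++⁻ zs (subst (suc i + 0 ∈_) α′≡ (∈-map⁺ (suc i +_) 0∈α′))
...   | inj₂ ∈π₂ = ⊥-elim (<-asym (+-monoʳ-< (suc i) z<s) (below (∈-++⁺ʳ (interval 0 (suc i)) (here refl)) ∈π₂))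
...   | inj₁ ∈zs = ⊥-elim (block-avoids-132 c (⊆-≼-trans pattern-132 π₁≼) z<s (+-monoʳ-< (suc i) z<s))
  where
  pattern-132 : 0 ∷ suc i + 1 ∷ suc i + 0 ∷ [] ⊆ interval 0 (suc i) ++ suc i + 1 ∷ zs
  pattern-132 = refl ∷ ⊆.++⁺ˡ (interval 1 i) (refl ∷ from∈ ∈zs)

-- Counting 𝒞 by compositions

∑ : {A : Set} → List A → (A → ℕ) → ℕ
∑ xs f = sum (map f xs)

∑-++ : ∀ {A : Set} (xs ys : List A) f → ∑ (xs ++ ys) f ≡ ∑ xs f + ∑ ys f
∑-++ xs ys f = trans (cong sum (map-++ f xs ys)) (sum-++ (map f xs) (map f ys))

∑-concatMap : ∀ {A B : Set} (g : A → List B) xs f → ∑ (concatMap g xs) f ≡ ∑ xs (λ x → ∑ (g x) f)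
∑-concatMap g [] f = refl
∑-concatMap g (x ∷ xs) f = trans (∑-++ (g x) _ f) (cong (∑ (g x) f +_) (∑-concatMap g xs f))

∑-map : ∀ {A B : Set} (g : A → B) xs f → ∑ (map g xs) f ≡ ∑ xs (f ∘ g)
∑-map g xs f = cong sum (sym (map-∘ xs))

∑-cong : ∀ {A : Set} {f g : A → ℕ} xs → (∀ x → f x ≡ g x) → ∑ xs f ≡ ∑ xs g
∑-cong xs f≗g = cong sum (map-cong f≗g xs)

∑-cong-∈ : ∀ {A : Set} {f g : A → ℕ} xs → (∀ {x} → x ∈ xs → f x ≡ g x) → ∑ xs f ≡ ∑ xs g
∑-cong-∈ xs f≗g = cong sum (map-cong-local (All.tabulate f≗g))

∑-∈-≤ : ∀ {A : Set} {p} xs (f : A → ℕ) → p ∈ xs → f p ≤ ∑ xs f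
∑-∈-≤ (p ∷ xs) f (here refl) = m≤m+n (f p) _
∑-∈-≤ (q ∷ xs) f (there p∈) = ≤-trans (∑-∈-≤ xs f p∈) (m≤n+m _ (f q))

∑-linear : ∀ {A : Set} xs (f g h : A → ℕ) r r′ → (∀ {p} → p ∈ xs → f p + h p * r ≡ g p + h p * r′) →
  ∑ xs f + ∑ xs h * r ≡ ∑ xs g + ∑ xs h * r′
∑-linear [] f g h r r′ _ = refl
∑-linear (p ∷ xs) f g h r r′ eq = begin
  (f p + ∑ xs f) + (h p + ∑ xs h) * r        ≡⟨ regroup (f p) (∑ xs f) (h p) (∑ xs h) r ⟩
  (f p + h p * r) + (∑ xs f + ∑ xs h * r)    ≡⟨ cong₂ _+_ (eq (here refl)) (∑-linear xs f g h r r′ (eq ∘ there)) ⟩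
  (g p + h p * r′) + (∑ xs g + ∑ xs h * r′)  ≡⟨ regroup (g p) (∑ xs g) (h p) (∑ xs h) r′ ⟨
  (g p + ∑ xs g) + (h p + ∑ xs h) * r′       ∎
  where
  open ≡-Reasoning
  regroup : ∀ x X y Y k → (x + X) + (y + Y) * k ≡ (x + y * k) + (X + Y * k)
  regroup = solve 5 (λ x X y Y k → (x :+ X) :+ (y :+ Y) :* k := (x :+ y :* k) :+ (X :+ Y :* k)) refl

count≡∑ : ∀ {A : Set} (p : A → Bool) xs → count p xs ≡ ∑ xs (χ ∘ p)
count≡∑ p [] = refl
count≡∑ p (x ∷ xs) with p x
... | true  = cong suc (count≡∑ p xs)
... | false = count≡∑ p xs

TwoSmallerAfter : List ℕ → Set
TwoSmallerAfter σ = ∃[ M ] ∃[ y ] ∃[ z ] (M ∷ y ∷ z ∷ [] ⊆ σ × y < M × z < M × y ≢ z)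

inC≡false⇔ : ∀ σ → inC σ ≡ false ⇔ TwoSmallerAfter σ
inC≡false⇔ σ = mk⇔ witness refute
  where
  p201 p210 : List ℕ
  p201 = 2 ∷ 0 ∷ 1 ∷ []
  p210 = 2 ∷ 1 ∷ 0 ∷ []
  triple : ∀ {u v t} → u ∷ v ∷ t ∷ [] ≼ σ → v < u → t < u → (v < t ⊎ t < v) → TwoSmallerAfter σ
  triple π≼ v<u t<u vt with occurrence³ π≼
  ... | M , y , z , s⊆ , conc =
    M , y , z , s⊆ , to (conc (there (here refl)) (here refl)) v<u , to (conc (there (there (here refl))) (here refl)) t<u ,
    λ { refl → [ (λ v<t → <-irrefl refl (to (conc (there (here refl)) (there (there (here refl)))) v<t))
               , (λ t<v → <-irrefl refl (to (conc (there (there (here refl))) (there (here refl))) t<v)) ]′ vt }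
  witness : inC σ ≡ false → TwoSmallerAfter σ
  witness notC with to (nor≡false⇔ (contains p201 σ) (contains p210 σ)) notC
  ... | inj₁ c201 = triple (≼-intro (from T-≡ c201)) z<s (s<s z<s) (inj₁ z<s)
  ... | inj₂ c210 = triple (≼-intro (from T-≡ c210)) (s<s z<s) z<s (inj₂ z<s)
  refute : TwoSmallerAfter σ → inC σ ≡ false
  refute (M , y , z , s⊆ , y<M , z<M , y≢z) with <-cmp y z
  ... | tri< y<z _ _ = from (nor≡false⇔ (contains p201 σ) (contains p210 σ)) (inj₁ (≼⇒contains≡true
        (occurrence⇒≼ (occurrence {p201} s⊆ (refl , allConcordant³
          (concordant-> z<s y<M) (concordant-< z<s y<M) (concordant-> (s<s z<s) z<M) (concordant-< (s<s z<s) z<M)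
          (concordant-< z<s y<z) (concordant-> z<s y<z))))))
  ... | tri≈ _ y≡z _ = ⊥-elim (y≢z y≡z)
  ... | tri> _ _ z<y = from (nor≡false⇔ (contains p201 σ) (contains p210 σ)) (inj₂ (≼⇒contains≡true
        (occurrence⇒≼ (occurrence {p210} s⊆ (refl , allConcordant³
          (concordant-> (s<s z<s) y<M) (concordant-< (s<s z<s) y<M) (concordant-> z<s z<M) (concordant-< z<s z<M)
          (concordant-> z<s z<y) (concordant-< z<s z<y))))))

TwoSmallerAfter-remove-max : ∀ {N} A B → All (_< N) A → length B ≤ 1 →
  TwoSmallerAfter (A ++ N ∷ B) → TwoSmallerAfter (A ++ B)
TwoSmallerAfter-remove-max A B A<N short (M , y , z , s⊆ , y<M , z<M , y≢z) with ⊆-++⁻ A (_ ∷ B) s⊆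
... | s₁ , s₂ , s≡ , s₁⊆ , (_ ∷ʳ s₂⊆) =
  M , y , z , subst (_⊆ A ++ B) (sym s≡) (⊆.++⁺ s₁⊆ s₂⊆) , y<M , z<M , y≢z
... | [] , _ ∷ s₂ , refl , _ , (refl ∷ s₂⊆) = ⊥-elim (<-irrefl refl (≤-trans (⊆.length-mono-≤ s₂⊆) short))
... | _ ∷ s₁ , _ ∷ s₂ , s≡ , s₁⊆ , (refl ∷ _) with ∷-injective s≡
...   | refl , rest≡ with subst (_ ∈_) (sym rest≡) (∈-++⁺ʳ s₁ (here refl))
...     | here refl = ⊥-elim (<-asym y<M (All.lookup A<N (⊆-lookup s₁⊆ (here refl))))
...     | there (here refl) = ⊥-elim (<-asym z<M (All.lookup A<N (⊆-lookup s₁⊆ (here refl))))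

inC-insert-max : ∀ {N} A B → All (_< N) A → length B ≤ 1 → inC (A ++ N ∷ B) ≡ inC (A ++ B)
inC-insert-max {N} A B A<N short = ⇔→≡ {z = false} (mk⇔
  (from (inC≡false⇔ _) ∘ TwoSmallerAfter-remove-max A B A<N short ∘ to (inC≡false⇔ _))
  (from (inC≡false⇔ _) ∘ widen ∘ to (inC≡false⇔ _)))
  where
  widen : TwoSmallerAfter (A ++ B) → TwoSmallerAfter (A ++ N ∷ B)
  widen (M , y , z , s⊆ , rest) = M , y , z , ⊆-trans s⊆ (⊆.++⁺ (⊆-refl {x = A}) (N ∷ʳ ⊆-refl)) , rest

inC-max-before-two : ∀ {N y z} A t → y < N → z < N → y ≢ z → inC (A ++ N ∷ y ∷ z ∷ t) ≡ false
inC-max-before-two A t y<N z<N y≢z =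
  from (inC≡false⇔ _) (_ , _ , _ , ⊆.++⁺ˡ A (refl ∷ refl ∷ refl ∷ minimum t) , y<N , z<N , y≢z)

on𝒞 : (List ℕ → ℕ) → List ℕ → ℕ
on𝒞 g σ = if inC σ then g σ else 0

insertBeforeLast : ℕ → List ℕ → List ℕ
insertBeforeLast N []          = [ N ]
insertBeforeLast N (y ∷ [])    = N ∷ y ∷ []
insertBeforeLast N (y ∷ z ∷ t) = y ∷ insertBeforeLast N (z ∷ t)

insertBeforeLast-++ : ∀ N A y B → insertBeforeLast N (A ++ y ∷ B) ≡ A ++ insertBeforeLast N (y ∷ B)
insertBeforeLast-++ N [] y B = refl
insertBeforeLast-++ N (x ∷ []) y B = refl
insertBeforeLast-++ N (x ∷ x′ ∷ A) y B = cong (x ∷_) (insertBeforeLast-++ N (x′ ∷ A) y B)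

insertBeforeLast-snoc : ∀ N A y → insertBeforeLast N (A ++ [ y ]) ≡ A ++ N ∷ y ∷ []
insertBeforeLast-snoc N A y = insertBeforeLast-++ N A y []

insertBeforeLast-++ʳ : ∀ N A B → 1 ≤ length B → insertBeforeLast N (A ++ B) ≡ A ++ insertBeforeLast N B
insertBeforeLast-++ʳ N A (y ∷ B) _ = insertBeforeLast-++ N A y B

map-insertBeforeLast : ∀ k N B → insertBeforeLast (k + N) (map (k +_) B) ≡ map (k +_) (insertBeforeLast N B)
map-insertBeforeLast k N [] = refl
map-insertBeforeLast k N (y ∷ []) = refl
map-insertBeforeLast k N (y ∷ z ∷ t) = cong (k + y ∷_) (map-insertBeforeLast k N (z ∷ t))

∑-insertions : ∀ g N pre y t → All (_< N) (y ∷ t) → Linked _≢_ (y ∷ t) →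
  ∑ (insertions N (y ∷ t)) (on𝒞 g ∘ (pre ++_)) ≡ on𝒞 g (pre ++ insertBeforeLast N (y ∷ t)) + on𝒞 g (pre ++ (y ∷ t) ++ [ N ])
∑-insertions g N pre y [] _ _ = cong (on𝒞 g (pre ++ N ∷ y ∷ []) +_) (+-identityʳ _)
∑-insertions g N pre y (z ∷ t) (y<N ∷ z<N∷t) (y≢z ∷ linked)
  rewrite inC-max-before-two pre t y<N (All.head z<N∷t) y≢z = begin
  ∑ (map (y ∷_) (insertions N (z ∷ t))) (on𝒞 g ∘ (pre ++_))
    ≡⟨ ∑-map (y ∷_) (insertions N (z ∷ t)) _ ⟩
  ∑ (insertions N (z ∷ t)) (λ σ → on𝒞 g (pre ++ y ∷ σ))
    ≡⟨ ∑-cong (insertions N (z ∷ t)) (λ σ → cong (on𝒞 g) (sym (++-assoc pre [ y ] σ))) ⟩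
  ∑ (insertions N (z ∷ t)) (on𝒞 g ∘ ((pre ++ [ y ]) ++_))
    ≡⟨ ∑-insertions g N (pre ++ [ y ]) z t z<N∷t linked ⟩
  on𝒞 g ((pre ++ [ y ]) ++ insertBeforeLast N (z ∷ t)) + on𝒞 g ((pre ++ [ y ]) ++ (z ∷ t) ++ [ N ])
    ≡⟨ cong₂ (λ u v → on𝒞 g u + on𝒞 g v) (++-assoc pre [ y ] _) (++-assoc pre [ y ] _) ⟩
  on𝒞 g (pre ++ y ∷ insertBeforeLast N (z ∷ t)) + on𝒞 g (pre ++ y ∷ (z ∷ t) ++ [ N ]) ∎
  where open ≡-Reasoning

insertions-head : ∀ N (τ : List ℕ) {s σ} → s ∷ σ ∈ insertions N τ → s ≡ N ⊎ ∃[ τ′ ] τ ≡ s ∷ τ′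
insertions-head N [] (here refl) = inj₁ refl
insertions-head N (y ∷ τ) (here refl) = inj₁ refl
insertions-head N (y ∷ τ) (there σ∈) with ∈-map⁻ (y ∷_) σ∈
... | _ , _ , refl = inj₂ (τ , refl)

insertions-invariant : ∀ N τ → All (_< N) τ → Linked _≢_ τ → ∀ {σ} → σ ∈ insertions N τ →
  All (_< suc N) σ × Linked _≢_ σ × length σ ≡ suc (length τ)
insertions-invariant N [] _ _ (here refl) = ≤-refl ∷ [] , [-] , refl
insertions-invariant N (y ∷ τ) y∷τ<N linked (here refl) =
  ≤-refl ∷ All.map m<n⇒m<1+n y∷τ<N , (λ N≡y → <-irrefl (sym N≡y) (All.head y∷τ<N)) ∷ linked , refl
insertions-invariant N (y ∷ τ) (y<N ∷ τ<N) linked (there σ∈) with ∈-map⁻ (y ∷_) σ∈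
... | σ′ , σ′∈ , refl with insertions-invariant N τ τ<N (Linked.tail linked) σ′∈
... | σ′<N , linked′ , len = m<n⇒m<1+n y<N ∷ σ′<N , extend σ′ σ′∈ linked′ , cong suc len
  where
  extend : ∀ σ′ → σ′ ∈ insertions N τ → Linked _≢_ σ′ → Linked _≢_ (y ∷ σ′)
  extend [] _ _ = [-]
  extend (s ∷ σ″) s∈ linked′ with insertions-head N τ s∈
  ... | inj₁ refl = (λ y≡N → <-irrefl y≡N y<N) ∷ linked′
  ... | inj₂ (_ , refl) = Linked.head linked ∷ linked′

perms-invariant : ∀ n {τ} → τ ∈ perms n → All (_< n) τ × Linked _≢_ τ × length τ ≡ n
perms-invariant zero (here refl) = [] , [] , refl
perms-invariant (suc n) τ∈ with find (∈-concatMap⁻ (insertions n) {perms n} τ∈)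
... | τ′ , τ′∈ , τ∈′ with perms-invariant n τ′∈
... | τ′<n , linked , len with insertions-invariant n τ′ τ′<n linked τ∈′
... | τ<n , linked′ , len′ = τ<n , linked′ , trans len′ (cong suc len)

inC-insertBeforeLast : ∀ N τ → All (_< N) τ → inC (insertBeforeLast N τ) ≡ inC τ
inC-insertBeforeLast N τ τ<N with initLast τ
... | [] = inC-insert-max {N} [] [] [] z≤n
... | A ∷ʳ′ y = trans (cong inC (insertBeforeLast-snoc N A y)) (inC-insert-max A [ y ] (All.++⁻ˡ A τ<N) ≤-refl)

inC-append-max : ∀ N τ → All (_< N) τ → inC (τ ++ [ N ]) ≡ inC τ
inC-append-max N τ τ<N = trans (inC-insert-max τ [] τ<N z≤n) (cong inC (++-identityʳ τ))

if-+ : ∀ {x₁ x₂ x} m n → x₁ ≡ x → x₂ ≡ x → (if x₁ then m else 0) + (if x₂ then n else 0) ≡ (if x then m + n else 0)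
if-+ {x = true}  m n refl refl = refl
if-+ {x = false} m n refl refl = refl

incrementLast : List ℕ → List ℕ
incrementLast []          = []
incrementLast (c ∷ [])    = suc c ∷ []
incrementLast (c ∷ d ∷ t) = c ∷ incrementLast (d ∷ t)

extensions : List ℕ → List (List ℕ)
extensions w = (w ++ [ 1 ]) ∷ incrementLast w ∷ []

-- Mirrors perms: the two extensions of w correspond to the only two insertions of a new
-- maximum into bsum w that stay in 𝒞.
compositions : ℕ → List (List ℕ)
compositions zero          = [ [] ]
compositions (suc zero)    = [ [ 1 ] ]
compositions (suc (suc n)) = concatMap extensions (compositions (suc n))

insertBeforeLast-block : ∀ c → insertBeforeLast (suc c) (block (suc c)) ≡ block (suc (suc c))
insertBeforeLast-block c = begin
  insertBeforeLast (suc c) (block (suc c))    ≡⟨ cong (insertBeforeLast (suc c)) (block-shape (suc c)) ⟩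
  insertBeforeLast (suc c) (interval 1 c ++ [ 0 ]) ≡⟨ insertBeforeLast-snoc (suc c) (interval 1 c) 0 ⟩
  interval 1 c ++ suc c ∷ 0 ∷ []              ≡⟨ ++-assoc (interval 1 c) [ suc c ] [ 0 ] ⟨
  (interval 1 c ++ [ suc c ]) ++ [ 0 ]        ≡⟨ cong (_++ [ 0 ]) (trans (cong (interval 1) (+-comm 1 c)) (interval-++ 1 c 1)) ⟨
  interval 1 (suc c) ++ [ 0 ]                 ≡⟨ block-shape (suc (suc c)) ⟨
  block (suc (suc c))                         ∎
  where open ≡-Reasoning

bsum-incrementLast : ∀ c w → All (1 ≤_) (c ∷ w) →
  bsum (incrementLast (c ∷ w)) ≡ insertBeforeLast (length (bsum (c ∷ w))) (bsum (c ∷ w))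
bsum-incrementLast (suc c) [] _ = begin
  block (suc (suc c)) ⊕ []                        ≡⟨ ⊕-identityʳ _ ⟩
  block (suc (suc c))                             ≡⟨ insertBeforeLast-block c ⟨
  insertBeforeLast (suc c) (block (suc c))        ≡⟨ cong₂ insertBeforeLast (sym (trans (length-⊕ (block (suc c)) []) (trans (+-identityʳ _) (length-block (suc c)))))
                                                                             (sym (⊕-identityʳ _)) ⟩
  insertBeforeLast (length (block (suc c) ⊕ [])) (block (suc c) ⊕ []) ∎
  where open ≡-Reasoning
bsum-incrementLast c (d ∷ t) (_ ∷ 1≤d∷t) = begin
  block c ++ map (L +_) (bsum (incrementLast (d ∷ t)))
    ≡⟨ cong (λ σ → block c ++ map (L +_) σ) (bsum-incrementLast d t 1≤d∷t) ⟩
  block c ++ map (L +_) (insertBeforeLast N (bsum (d ∷ t)))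
    ≡⟨ cong (block c ++_) (map-insertBeforeLast L N (bsum (d ∷ t))) ⟨
  block c ++ insertBeforeLast (L + N) (map (L +_) (bsum (d ∷ t)))
    ≡⟨ insertBeforeLast-++ʳ (L + N) (block c) _ nonempty ⟨
  insertBeforeLast (L + N) (block c ⊕ bsum (d ∷ t))
    ≡⟨ cong (λ n → insertBeforeLast n (block c ⊕ bsum (d ∷ t))) (length-⊕ (block c) (bsum (d ∷ t))) ⟨
  insertBeforeLast (length (block c ⊕ bsum (d ∷ t))) (block c ⊕ bsum (d ∷ t)) ∎
  where
  open ≡-Reasoning
  L = length (block c)
  N = length (bsum (d ∷ t))
  nonempty : 1 ≤ length (map (L +_) (bsum (d ∷ t)))
  nonempty = subst (1 ≤_) (sym (trans (length-map (L +_) (bsum (d ∷ t))) (length-bsum-∷ d t))) (s≤s z≤n)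

compositions-invariant : ∀ m {w} → w ∈ compositions (suc m) →
  ∃₂ (λ c w′ → w ≡ c ∷ w′) × All (1 ≤_) w × length (bsum w) ≡ suc m
compositions-invariant zero (here refl) = (1 , [] , refl) , s≤s z≤n ∷ [] , refl
compositions-invariant (suc m) w∈ with find (∈-concatMap⁻ extensions {compositions (suc m)} w∈)
... | w′ , w′∈ , ext∈ with compositions-invariant m w′∈
... | (c , w″ , refl) , 1≤w′ , len with ext∈
...   | here refl = (c , _ , refl) , All.++⁺ 1≤w′ (s≤s z≤n ∷ []) ,
        trans (cong length (bsum-++[1] (c ∷ w″))) (trans (length-++ (bsum (c ∷ w″))) (trans (+-comm _ 1) (cong suc len)))
...   | there (here refl) = nonempty c w″ , incrementLast-positive c w″ 1≤w′ ,
        trans (cong length (bsum-incrementLast c w″ 1≤w′))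
              (trans (length-insertBeforeLast _ (bsum (c ∷ w″))) (cong suc len))
  where
  nonempty : ∀ c w → ∃₂ λ c′ w′ → incrementLast (c ∷ w) ≡ c′ ∷ w′
  nonempty c [] = suc c , [] , refl
  nonempty c (d ∷ w) = c , _ , refl
  incrementLast-positive : ∀ c w → All (1 ≤_) (c ∷ w) → All (1 ≤_) (incrementLast (c ∷ w))
  incrementLast-positive c [] _ = s≤s z≤n ∷ []
  incrementLast-positive c (d ∷ w) (1≤c ∷ 1≤d∷w) = 1≤c ∷ incrementLast-positive d w 1≤d∷w
  length-insertBeforeLast : ∀ N xs → length (insertBeforeLast N xs) ≡ suc (length xs)
  length-insertBeforeLast N [] = refl
  length-insertBeforeLast N (y ∷ []) = refl
  length-insertBeforeLast N (y ∷ z ∷ t) = cong suc (length-insertBeforeLast N (z ∷ t))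

∑-perms-on𝒞 : ∀ n g → ∑ (perms n) (on𝒞 g) ≡ ∑ (compositions n) (g ∘ bsum)
∑-perms-on𝒞 zero g = refl
∑-perms-on𝒞 (suc zero) g = refl
∑-perms-on𝒞 (suc (suc m)) g = begin
  ∑ (concatMap (insertions N) (perms N)) (on𝒞 g)          ≡⟨ ∑-concatMap (insertions N) (perms N) (on𝒞 g) ⟩
  ∑ (perms N) (λ τ → ∑ (insertions N τ) (on𝒞 g))          ≡⟨ ∑-cong-∈ (perms N) inserted ⟩
  ∑ (perms N) (on𝒞 g′)                                    ≡⟨ ∑-perms-on𝒞 (suc m) g′ ⟩
  ∑ (compositions N) (g′ ∘ bsum)                          ≡⟨ ∑-cong-∈ (compositions N) extended ⟩
  ∑ (compositions N) (λ w → ∑ (extensions w) (g ∘ bsum))  ≡⟨ ∑-concatMap extensions (compositions N) (g ∘ bsum) ⟨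
  ∑ (concatMap extensions (compositions N)) (g ∘ bsum)    ∎
  where
  open ≡-Reasoning
  N = suc m
  g′ : List ℕ → ℕ
  g′ τ = g (insertBeforeLast N τ) + g (τ ++ [ N ])
  inserted : ∀ {τ} → τ ∈ perms N → ∑ (insertions N τ) (on𝒞 g) ≡ on𝒞 g′ τ
  inserted {[]} τ∈ with perms-invariant N τ∈
  ... | _ , _ , ()
  inserted {y ∷ t} τ∈ with perms-invariant N τ∈
  ... | τ<N , linked , _ = trans (∑-insertions g N [] y t τ<N linked)
        (if-+ _ _ (inC-insertBeforeLast N (y ∷ t) τ<N) (inC-append-max N (y ∷ t) τ<N))
  extended : ∀ {w} → w ∈ compositions N → g′ (bsum w) ≡ ∑ (extensions w) (g ∘ bsum)
  extended w∈ with compositions-invariant m w∈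
  ... | (c , w , refl) , 1≤w , len = begin
    g (insertBeforeLast N (bsum (c ∷ w))) + g (bsum (c ∷ w) ++ [ N ])
      ≡⟨ cong₂ (λ n n′ → g (insertBeforeLast n (bsum (c ∷ w))) + g (bsum (c ∷ w) ++ [ n′ ])) (sym len) (sym len) ⟩
    g (insertBeforeLast (length (bsum (c ∷ w))) (bsum (c ∷ w))) + g (bsum (c ∷ w) ++ [ length (bsum (c ∷ w)) ])
      ≡⟨ cong₂ (λ σ σ′ → g σ + g σ′) (bsum-incrementLast c w 1≤w) (bsum-++[1] (c ∷ w)) ⟨
    g (bsum (incrementLast (c ∷ w))) + g (bsum ((c ∷ w) ++ [ 1 ]))
      ≡⟨ +-comm (g (bsum (incrementLast (c ∷ w)))) _ ⟩
    g (bsum ((c ∷ w) ++ [ 1 ])) + g (bsum (incrementLast (c ∷ w)))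
      ≡⟨ cong (g (bsum ((c ∷ w) ++ [ 1 ])) +_) (+-identityʳ _) ⟨
    ∑ (extensions (c ∷ w)) (g ∘ bsum) ∎

avoiders : List ℕ → ℕ → ℕ
avoiders π n = ∑ (compositions n) (λ w → χ (not (contains π (bsum w))))

avCount≡avoiders : ∀ π n → avCount π n ≡ avoiders π n
avCount≡avoiders π n = begin
  avCount π n                                            ≡⟨ count≡∑ _ (perms n) ⟩
  ∑ (perms n) (λ σ → χ (inC σ ∧ not (contains π σ)))    ≡⟨ ∑-cong (perms n) (λ σ → χ-∧ (inC σ) _) ⟩
  ∑ (perms n) (on𝒞 (λ σ → χ (not (contains π σ))))      ≡⟨ ∑-perms-on𝒞 n _ ⟩
  avoiders π n                                           ∎
  where
  open ≡-Reasoning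
  χ-∧ : ∀ x y → χ (x ∧ y) ≡ (if x then χ y else 0)
  χ-∧ true  y = refl
  χ-∧ false y = refl

-- Compositions by their first part

antidiagonal : ℕ → ℕ → List (ℕ × ℕ)
antidiagonal c zero    = [ (c , 0) ]
antidiagonal c (suc k) = (c , suc k) ∷ antidiagonal (suc c) k

∈-antidiagonal⁻ : ∀ {c′ m} c k → (c′ , m) ∈ antidiagonal c k → c ≤ c′ × c′ + m ≡ c + k
∈-antidiagonal⁻ c zero (here refl) = ≤-refl , refl
∈-antidiagonal⁻ c (suc k) (here refl) = ≤-refl , refl
∈-antidiagonal⁻ c (suc k) (there p∈) with ∈-antidiagonal⁻ (suc c) k p∈
... | c<c′ , sum≡ = <⇒≤ c<c′ , trans sum≡ (sym (+-suc c k))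

∈-antidiagonal⁺ : ∀ {c} i k → (c + i , k) ∈ antidiagonal c (i + k)
∈-antidiagonal⁺ {c} zero zero = here (cong (_, 0) (+-identityʳ c))
∈-antidiagonal⁺ {c} zero (suc k) = here (cong (_, suc k) (+-identityʳ c))
∈-antidiagonal⁺ {c} (suc i) k =
  there (subst (λ c′ → (c′ , k) ∈ antidiagonal (suc c) (i + k)) (sym (+-suc c i)) (∈-antidiagonal⁺ i k))

antidiagonal-< : ∀ {c m n} → (c , m) ∈ antidiagonal 1 n → m < suc n
antidiagonal-< {c} {m} {n} cm∈ = let 1≤c , c+m≡ = ∈-antidiagonal⁻ 1 n cm∈ in subst (m <_) c+m≡ (m<n+m m 1≤c)

∑-antidiagonal-peel : ∀ c k (h : ℕ → ℕ → ℕ) → ∑ (antidiagonal c (suc k)) (uncurry h) ≡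
  ∑ (antidiagonal c k) (uncurry λ c′ m → h c′ (suc m)) + h (c + suc k) 0
∑-antidiagonal-peel c zero h = begin
  h c 1 + (h (suc c) 0 + 0) ≡⟨ cong (h c 1 +_) (+-identityʳ _) ⟩
  h c 1 + h (suc c) 0       ≡⟨ cong (λ c′ → h c 1 + h c′ 0) (+-comm 1 c) ⟩
  h c 1 + h (c + 1) 0       ≡⟨ cong (_+ h (c + 1) 0) (+-identityʳ _) ⟨
  (h c 1 + 0) + h (c + 1) 0 ∎
  where open ≡-Reasoning
∑-antidiagonal-peel c (suc k) h = begin
  h c (2 + k) + ∑ (antidiagonal (suc c) (suc k)) (uncurry h)
    ≡⟨ cong (h c (2 + k) +_) (∑-antidiagonal-peel (suc c) k h) ⟩
  h c (2 + k) + (∑ (antidiagonal (suc c) k) (uncurry λ c′ m → h c′ (suc m)) + h (suc c + suc k) 0)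
    ≡⟨ +-assoc (h c (2 + k)) _ _ ⟨
  h c (2 + k) + ∑ (antidiagonal (suc c) k) (uncurry λ c′ m → h c′ (suc m)) + h (suc c + suc k) 0
    ≡⟨ cong (λ c′ → h c (2 + k) + ∑ (antidiagonal (suc c) k) (uncurry λ c′ m → h c′ (suc m)) + h c′ 0) (+-suc c (suc k)) ⟨
  h c (2 + k) + ∑ (antidiagonal (suc c) k) (uncurry λ c′ m → h c′ (suc m)) + h (c + suc (suc k)) 0 ∎
  where open ≡-Reasoning

ifZero : ℕ → ℕ → ℕ
ifZero zero    x = x
ifZero (suc _) _ = 0

∑-antidiagonal-ifZero : ∀ c k (f : ℕ → ℕ → ℕ) (e : ℕ → ℕ) →
  ∑ (antidiagonal c k) (uncurry λ c′ m → f c′ m + ifZero m (e c′)) ≡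
  ∑ (antidiagonal c k) (uncurry f) + e (c + k)
∑-antidiagonal-ifZero c zero f e = begin
  (f c 0 + e c) + 0 ≡⟨ +-identityʳ _ ⟩
  f c 0 + e c       ≡⟨ cong (λ c′ → f c 0 + e c′) (+-identityʳ c) ⟨
  f c 0 + e (c + 0) ≡⟨ cong (_+ e (c + 0)) (+-identityʳ _) ⟨
  (f c 0 + 0) + e (c + 0) ∎
  where open ≡-Reasoning
∑-antidiagonal-ifZero c (suc k) f e = begin
  (f c (suc k) + 0) + ∑ (antidiagonal (suc c) k) (uncurry λ c′ m → f c′ m + ifZero m (e c′))
    ≡⟨ cong₂ _+_ (+-identityʳ _) (∑-antidiagonal-ifZero (suc c) k f e) ⟩
  f c (suc k) + (∑ (antidiagonal (suc c) k) (uncurry f) + e (suc c + k))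
    ≡⟨ +-assoc (f c (suc k)) _ _ ⟨
  f c (suc k) + ∑ (antidiagonal (suc c) k) (uncurry f) + e (suc c + k)
    ≡⟨ cong (λ c′ → f c (suc k) + ∑ (antidiagonal (suc c) k) (uncurry f) + e c′) (+-suc c k) ⟨
  f c (suc k) + ∑ (antidiagonal (suc c) k) (uncurry f) + e (c + suc k) ∎
  where open ≡-Reasoning

∑-compositions-by-first : ∀ n g → ∑ (compositions (suc n)) g ≡
  ∑ (antidiagonal 1 n) (uncurry λ c m → ∑ (compositions m) (g ∘ (c ∷_)))
∑-compositions-by-first zero g = sym (+-identityʳ _)
∑-compositions-by-first (suc n) g = begin
  ∑ (concatMap extensions (compositions (suc n))) g
    ≡⟨ ∑-concatMap extensions (compositions (suc n)) g ⟩
  ∑ (compositions (suc n)) g′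
    ≡⟨ ∑-compositions-by-first n g′ ⟩
  ∑ (antidiagonal 1 n) (uncurry λ c m → ∑ (compositions m) (g′ ∘ (c ∷_)))
    ≡⟨ ∑-cong (antidiagonal 1 n) (λ (c , m) → first-part c m) ⟩
  ∑ (antidiagonal 1 n) (uncurry λ c m → H c (suc m) + ifZero m (g [ suc c ]))
    ≡⟨ ∑-antidiagonal-ifZero 1 n (λ c m → H c (suc m)) (λ c → g [ suc c ]) ⟩
  ∑ (antidiagonal 1 n) (uncurry λ c m → H c (suc m)) + g [ 2 + n ]
    ≡⟨ cong (∑ (antidiagonal 1 n) (uncurry λ c m → H c (suc m)) +_) (+-identityʳ _) ⟨
  ∑ (antidiagonal 1 n) (uncurry λ c m → H c (suc m)) + H (2 + n) 0
    ≡⟨ ∑-antidiagonal-peel 1 n H ⟨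
  ∑ (antidiagonal 1 (suc n)) (uncurry H) ∎
  where
  open ≡-Reasoning
  g′ : List ℕ → ℕ
  g′ w = ∑ (extensions w) g
  H : ℕ → ℕ → ℕ
  H c m = ∑ (compositions m) (g ∘ (c ∷_))
  first-part : ∀ c m → ∑ (compositions m) (g′ ∘ (c ∷_)) ≡ H c (suc m) + ifZero m (g [ suc c ])
  first-part c zero = begin
    (g (c ∷ 1 ∷ []) + (g [ suc c ] + 0)) + 0 ≡⟨ +-identityʳ _ ⟩
    g (c ∷ 1 ∷ []) + (g [ suc c ] + 0)       ≡⟨ cong (g (c ∷ 1 ∷ []) +_) (+-identityʳ _) ⟩
    g (c ∷ 1 ∷ []) + g [ suc c ]             ≡⟨ cong (_+ g [ suc c ]) (+-identityʳ _) ⟨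
    (g (c ∷ 1 ∷ []) + 0) + g [ suc c ]       ∎
  first-part c (suc m) = begin
    ∑ (compositions (suc m)) (g′ ∘ (c ∷_))
      ≡⟨ ∑-cong-∈ (compositions (suc m)) extend-tail ⟩
    ∑ (compositions (suc m)) (λ w → ∑ (extensions w) (g ∘ (c ∷_)))
      ≡⟨ ∑-concatMap extensions (compositions (suc m)) (g ∘ (c ∷_)) ⟨
    H c (2 + m)
      ≡⟨ +-identityʳ _ ⟨
    H c (2 + m) + 0 ∎
    where
    extend-tail : ∀ {w} → w ∈ compositions (suc m) → g′ (c ∷ w) ≡ ∑ (extensions w) (g ∘ (c ∷_))
    extend-tail w∈ with compositions-invariant m w∈
    ... | (d , w , refl) , _ = refl

-- Counting through the leftmost occurrence of x

length-bsum-antidiagonal : ∀ p {c k n} → (c , k) ∈ antidiagonal 1 n → length (bsum (p ++ [ c ])) + k ≡ length (bsum p) + suc n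
length-bsum-antidiagonal p {c} {k} {n} ck∈ = let 1≤c , c+k≡ = ∈-antidiagonal⁻ 1 n ck∈ in begin
  length (bsum (p ++ [ c ])) + k ≡⟨ cong (_+ k) (length-bsum-snoc p c 1≤c) ⟩
  length (bsum p) + c + k        ≡⟨ +-assoc (length (bsum p)) c k ⟩
  length (bsum p) + (c + k)      ≡⟨ cong (length (bsum p) +_) c+k≡ ⟩
  length (bsum p) + suc n        ∎
  where open ≡-Reasoning

module Greedy (x : List ℕ) where

  containsX : List ℕ → Bool
  containsX p = contains x (bsum p)

  greedy : List ℕ → List ℕ → List ℕ → Bool
  greedy α p []      = containsX p ∧ contains α []
  greedy α p (c ∷ w) = if containsX p then contains α (bsum (c ∷ w)) else greedy α (p ++ [ c ]) w

  greedy-found : ∀ α p w → containsX p ≡ true → greedy α p w ≡ contains α (bsum w)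
  greedy-found α p [] found = cong (_∧ contains α []) found
  greedy-found α p (c ∷ w) found = cong (λ z → if z then contains α (bsum (c ∷ w)) else greedy α (p ++ [ c ]) w) found

  greedy-missing : ∀ α p c w → containsX p ≡ false → greedy α p (c ∷ w) ≡ greedy α (p ++ [ c ]) w
  greedy-missing α p c w missing = cong (λ z → if z then contains α (bsum (c ∷ w)) else greedy α (p ++ [ c ]) w) missing

  greedy⇒split : ∀ α p w → greedy α p w ≡ true →
    ∃₂ λ w₁ w₂ → w ≡ w₁ ++ w₂ × containsX (p ++ w₁) ≡ true × contains α (bsum w₂) ≡ true
  greedy⇒split α p w g with true-or-false (containsX p)
  ... | inj₁ found = [] , w , refl , trans (cong containsX (++-identityʳ p)) found , trans (sym (greedy-found α p w found)) g
  greedy⇒split α p [] g | inj₂ missing with trans (sym g) (cong (_∧ contains α []) missing)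
  ... | ()
  greedy⇒split α p (c ∷ w) g | inj₂ missing with greedy⇒split α (p ++ [ c ]) w (trans (sym (greedy-missing α p c w missing)) g)
  ... | w₁ , w₂ , refl , found′ , α∈ = c ∷ w₁ , w₂ , refl , trans (cong containsX (sym (++-assoc p [ c ] w₁))) found′ , α∈

  split⇒greedy : ∀ α p w₁ w₂ → containsX (p ++ w₁) ≡ true → contains α (bsum w₂) ≡ true →
    greedy α p (w₁ ++ w₂) ≡ true
  split⇒greedy α p w₁ w₂ found′ α∈ with true-or-false (containsX p)
  ... | inj₁ found = trans (greedy-found α p (w₁ ++ w₂) found)
                     (≼⇒contains≡true (subst (α ≼_) (sym (bsum-++ w₁ w₂)) (≼-⊕ʳ (bsum w₁) (≼-intro (from T-≡ α∈)))))
  split⇒greedy α p [] w₂ found′ α∈ | inj₂ missing with trans (sym found′) (trans (cong containsX (++-identityʳ p)) missing)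
  ... | ()
  split⇒greedy α p (c ∷ w₁) w₂ found′ α∈ | inj₂ missing =
    trans (greedy-missing α p c (w₁ ++ w₂) missing)
          (split⇒greedy α (p ++ [ c ]) w₁ w₂ (trans (cong containsX (++-assoc p [ c ] w₁)) found′) α∈)

  splittable⇒contains≡greedy : ∀ α → Bounded x → Splittable x α → ∀ w → contains (x ⊕ α) (bsum w) ≡ greedy α [] w
  splittable⇒contains≡greedy α bx splittable w = T-injective (greedy⁺ w ∘ splittable w ∘ ≼-intro) (≼-holds ∘ greedy⁻)
    where
    greedy⁺ : ∀ w → Splits x α w → T (greedy α [] w)
    greedy⁺ _ (w₁ , w₂ , refl , x≼ , α≼) =
      from T-≡ (split⇒greedy α [] w₁ w₂ (≼⇒contains≡true x≼) (≼⇒contains≡true α≼))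
    greedy⁻ : T (greedy α [] w) → x ⊕ α ≼ bsum w
    greedy⁻ g with greedy⇒split α [] w (to T-≡ g)
    ... | w₁ , w₂ , refl , found , α∈ =
      splits⇒≼ α bx (w₁ , w₂ , refl , ≼-intro (from T-≡ found) , ≼-intro (from T-≡ α∈))

  notGreedy : List ℕ → List ℕ → ℕ → ℕ
  notGreedy α p n = ∑ (compositions n) (λ w → χ (not (greedy α p w)))

  notGreedy-found : ∀ α p n → containsX p ≡ true → notGreedy α p n ≡ avoiders α n
  notGreedy-found α p n found = ∑-cong (compositions n) (λ w → cong (χ ∘ not) (greedy-found α p w found))

  notGreedy-zero : ∀ α p → containsX p ≡ false → notGreedy α p 0 ≡ 1
  notGreedy-zero α p missing = cong (λ z → χ (not (z ∧ contains α [])) + 0) missing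

  notGreedy-suc : ∀ α p n → containsX p ≡ false →
    notGreedy α p (suc n) ≡ ∑ (antidiagonal 1 n) (uncurry λ c m → notGreedy α (p ++ [ c ]) m)
  notGreedy-suc α p n missing = trans (∑-compositions-by-first n _)
    (∑-cong (antidiagonal 1 n) λ (c , m) → ∑-cong (compositions m) λ w → cong (χ ∘ not) (greedy-missing α p c w missing))

  notGreedy-cong : ∀ α β → (∀ n → avoiders α n ≡ avoiders β n) → ∀ n p → notGreedy α p n ≡ notGreedy β p n
  notGreedy-cong α β same = <-rec _ step
    where
    step : ∀ n → (∀ {n′} → n′ < n → ∀ p → notGreedy α p n′ ≡ notGreedy β p n′) →
           ∀ p → notGreedy α p n ≡ notGreedy β p n
    step n ih p with true-or-false (containsX p)
    ... | inj₁ found = trans (notGreedy-found α p n found) (trans (same n) (sym (notGreedy-found β p n found)))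
    step zero ih p | inj₂ missing = trans (notGreedy-zero α p missing) (sym (notGreedy-zero β p missing))
    step (suc n) ih p | inj₂ missing = trans (notGreedy-suc α p n missing)
      (trans (∑-cong-∈ (antidiagonal 1 n) (λ {(c , m)} cm∈ → ih (antidiagonal-< cm∈) (p ++ [ c ])))
             (sym (notGreedy-suc β p n missing)))

  -- paths m p n counts the sequences of positive parts c₁, …, cᵣ with sum n ∸ m such that x
  -- occurs in bsum (p ++ c₁ ⋯ cᵣ) but in no bsum (p ++ c₁ ⋯ cᵢ) with i < r; it is 0 when n < m.
  mutual
    paths : ℕ → List ℕ → ℕ → ℕ
    paths m p n = if containsX p then χ (n ≡ᵇ m) else paths-after m p n

    paths-after : ℕ → List ℕ → ℕ → ℕ
    paths-after m p zero    = 0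
    paths-after m p (suc n) = paths-from m p 1 n

    paths-from : ℕ → List ℕ → ℕ → ℕ → ℕ
    paths-from m p c zero    = paths m (p ++ [ c ]) zero
    paths-from m p c (suc k) = paths m (p ++ [ c ]) (suc k) + paths-from m p (suc c) k

  paths-found : ∀ m p n → containsX p ≡ true → paths m p n ≡ χ (n ≡ᵇ m)
  paths-found m p n found = cong (λ z → if z then χ (n ≡ᵇ m) else paths-after m p n) found

  paths-missing : ∀ m p n → containsX p ≡ false → paths m p n ≡ paths-after m p n
  paths-missing m p n missing = cong (λ z → if z then χ (n ≡ᵇ m) else paths-after m p n) missing

  paths-from≡∑ : ∀ m p c k → paths-from m p c k ≡ ∑ (antidiagonal c k) (uncurry λ c′ k′ → paths m (p ++ [ c′ ]) k′)
  paths-from≡∑ m p c zero    = sym (+-identityʳ _)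
  paths-from≡∑ m p c (suc k) = cong (paths m (p ++ [ c ]) (suc k) +_) (paths-from≡∑ m p (suc c) k)

  paths-extend : ∀ m p c n → containsX p ≡ false → paths m (p ++ [ suc c ]) n ≤ paths m p (suc c + n)
  paths-extend m p c n missing = begin
    paths m (p ++ [ suc c ]) n
      ≤⟨ ∑-∈-≤ (antidiagonal 1 (c + n)) (uncurry λ c′ k′ → paths m (p ++ [ c′ ]) k′) (∈-antidiagonal⁺ c n) ⟩
    ∑ (antidiagonal 1 (c + n)) (uncurry λ c′ k′ → paths m (p ++ [ c′ ]) k′)
      ≡⟨ paths-from≡∑ m p 1 (c + n) ⟨
    paths-after m p (suc c + n)
      ≡⟨ paths-missing m p (suc c + n) missing ⟨
    paths m p (suc c + n) ∎
    where open ≤-Reasoning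

  notGreedy-linear-found : ∀ α β m → (∀ {m′} → m′ < m → avoiders α m′ ≡ avoiders β m′) → ∀ n p →
    length (bsum p) + n ≡ length x + m → containsX p ≡ true →
    notGreedy α p n + paths m p n * avoiders β m ≡ notGreedy β p n + paths m p n * avoiders α m
  notGreedy-linear-found α β m below n p len found = begin
    notGreedy α p n + paths m p n * Aβ    ≡⟨ cong₂ (λ t h → t + h * Aβ) (notGreedy-found α p n found) (paths-found m p n found) ⟩
    avoiders α n + χ (n ≡ᵇ m) * Aβ        ≡⟨ remainder (m≤n⇒m<n∨m≡n n≤m) ⟩
    avoiders β n + χ (n ≡ᵇ m) * Aα        ≡⟨ cong₂ (λ t h → t + h * Aα) (notGreedy-found β p n found) (paths-found m p n found) ⟨
    notGreedy β p n + paths m p n * Aα    ∎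
    where
    open ≡-Reasoning
    Aα = avoiders α m
    Aβ = avoiders β m
    n≤m : n ≤ m
    n≤m = +-cancelˡ-≤ (length (bsum p)) n m
            (≤-trans (≤-reflexive len) (+-monoˡ-≤ m (≼⇒length≤ x (bsum p) (≼-intro (from T-≡ found)))))
    remainder : n < m ⊎ n ≡ m → avoiders α n + χ (n ≡ᵇ m) * Aβ ≡ avoiders β n + χ (n ≡ᵇ m) * Aα
    remainder (inj₁ n<m) rewrite ≡ᵇ-false (<⇒≢ n<m) = cong (_+ 0) (below n<m)
    remainder (inj₂ refl) rewrite ≡ᵇ-refl n =
      trans (cong (Aα +_) (+-identityʳ Aβ)) (trans (+-comm Aα Aβ) (cong (Aβ +_) (sym (+-identityʳ Aα))))

  -- notGreedy α p n − notGreedy β p n = paths m p n · (avoiders α m − avoiders β m), stated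
  -- without subtraction; length (bsum p) + n ≡ length x + m rules out remainders above m.
  notGreedy-linear : ∀ α β m → (∀ {m′} → m′ < m → avoiders α m′ ≡ avoiders β m′) → ∀ n p →
    length (bsum p) + n ≡ length x + m →
    notGreedy α p n + paths m p n * avoiders β m ≡ notGreedy β p n + paths m p n * avoiders α m
  notGreedy-linear α β m below = <-rec _ step
    where
    Aα = avoiders α m
    Aβ = avoiders β m
    step : ∀ n → (∀ {n′} → n′ < n → ∀ p → length (bsum p) + n′ ≡ length x + m →
             notGreedy α p n′ + paths m p n′ * Aβ ≡ notGreedy β p n′ + paths m p n′ * Aα) →
           ∀ p → length (bsum p) + n ≡ length x + m →
           notGreedy α p n + paths m p n * Aβ ≡ notGreedy β p n + paths m p n * Aα
    step n ih p len with true-or-false (containsX p)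
    ... | inj₁ found = notGreedy-linear-found α β m below n p len found
    step zero ih p len | inj₂ missing = trans
      (cong₂ (λ t h → t + h * Aβ) (notGreedy-zero α p missing) (paths-missing m p 0 missing))
      (sym (cong₂ (λ t h → t + h * Aα) (notGreedy-zero β p missing) (paths-missing m p 0 missing)))
    step (suc n) ih p len | inj₂ missing = begin
      notGreedy α p (suc n) + paths m p (suc n) * Aβ
        ≡⟨ cong₂ (λ t h → t + h * Aβ) (notGreedy-suc α p n missing) paths≡ ⟩
      ∑ AD (uncurry λ c k → notGreedy α (p ++ [ c ]) k) + ∑ AD (uncurry λ c k → paths m (p ++ [ c ]) k) * Aβ
        ≡⟨ ∑-linear AD _ _ _ Aβ Aα (λ {(c , k)} ck∈ →
             ih (antidiagonal-< ck∈) (p ++ [ c ]) (trans (length-bsum-antidiagonal p ck∈) len)) ⟩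
      ∑ AD (uncurry λ c k → notGreedy β (p ++ [ c ]) k) + ∑ AD (uncurry λ c k → paths m (p ++ [ c ]) k) * Aα
        ≡⟨ cong₂ (λ t h → t + h * Aα) (notGreedy-suc β p n missing) paths≡ ⟨
      notGreedy β p (suc n) + paths m p (suc n) * Aα ∎
      where
      open ≡-Reasoning
      AD = antidiagonal 1 n
      paths≡ : paths m p (suc n) ≡ ∑ AD (uncurry λ c k → paths m (p ++ [ c ]) k)
      paths≡ = trans (paths-missing m p (suc n) missing) (paths-from≡∑ m p 1 n)

  avoiders-determined : ∀ α β → (∀ m → 1 ≤ paths m [] (length x + m)) →
    (∀ n → notGreedy α [] n ≡ notGreedy β [] n) → ∀ m → avoiders α m ≡ avoiders β m
  avoiders-determined α β positive same = <-rec _ step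
    where
    step : ∀ m → (∀ {m′} → m′ < m → avoiders α m′ ≡ avoiders β m′) → avoiders α m ≡ avoiders β m
    step m below = sym (*-cancelˡ-≡ _ _ (paths m [] n) {{>-nonZero (positive m)}}
      (+-cancelˡ-≡ (notGreedy β [] n) _ _
        (trans (cong (_+ paths m [] n * avoiders β m) (sym (same n))) (notGreedy-linear α β m below n [] refl))))
      where n = length x + m

  wilf⇔ : ∀ {α β} → Bounded x → (∀ m → 1 ≤ paths m [] (length x + m)) → Splittable x α → Splittable x β →
    WilfEq (x ⊕ α) (x ⊕ β) ⇔ WilfEq α β
  wilf⇔ {α} {β} bx positive splitα splitβ = mk⇔
    (λ wilf m → begin
      avCount α m   ≡⟨ avCount≡avoiders α m ⟩
      avoiders α m  ≡⟨ avoiders-determined α β positive (λ n → trans (sym (avCount≡notGreedy α splitα n))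
                                                                  (trans (wilf n) (avCount≡notGreedy β splitβ n))) m ⟩
      avoiders β m  ≡⟨ avCount≡avoiders β m ⟨
      avCount β m   ∎)
    (λ wilf n → begin
      avCount (x ⊕ α) n  ≡⟨ avCount≡notGreedy α splitα n ⟩
      notGreedy α [] n   ≡⟨ notGreedy-cong α β (λ m → trans (sym (avCount≡avoiders α m)) (trans (wilf m) (avCount≡avoiders β m))) n [] ⟩
      notGreedy β [] n   ≡⟨ avCount≡notGreedy β splitβ n ⟨
      avCount (x ⊕ β) n  ∎)
    where
    open ≡-Reasoning
    avCount≡notGreedy : ∀ γ → Splittable x γ → ∀ n → avCount (x ⊕ γ) n ≡ notGreedy γ [] n
    avCount≡notGreedy γ splitγ n = trans (avCount≡avoiders (x ⊕ γ) n)
      (∑-cong (compositions n) (λ w → cong (χ ∘ not) (splittable⇒contains≡greedy γ bx splitγ w)))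

b-paths-positive : ∀ k m → 1 ≤ Greedy.paths (block (2 + k)) m [] (length (block (2 + k)) + m)
b-paths-positive k m = begin
  1                              ≡⟨ cong χ (≡ᵇ-refl m) ⟨
  χ (m ≡ᵇ m)                     ≡⟨ paths-found m [ 2 + k ] m found ⟨
  paths m [ 2 + k ] m            ≤⟨ paths-extend m [] (suc k) m refl ⟩
  paths m [] (2 + k + m)         ≡⟨ cong (λ n → paths m [] (n + m)) (length-block (2 + k)) ⟨
  paths m [] (length x + m)      ∎
  where
  x = block (2 + k)
  open Greedy x
  open ≤-Reasoning
  found : containsX [ 2 + k ] ≡ true
  found = ≼⇒contains≡true (subst (x ≼_) (sym (⊕-identityʳ x)) (≼-refl x))

a-paths-positive : ∀ i m → 1 ≤ Greedy.paths (interval 0 i) m [] (length (interval 0 i) + m)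
a-paths-positive i m = subst (λ n → 1 ≤ paths m [] (n + m)) (sym (length-interval 0 i)) (from-ones i 0 refl)
  where
  open Greedy (interval 0 i)
  open ≤-Reasoning
  ones : ℕ → List ℕ
  ones d = replicate d 1
  missing : ∀ d → d < i → containsX (ones d) ≡ false
  missing d d<i with true-or-false (containsX (ones d))
  ... | inj₂ e = e
  ... | inj₁ e = ⊥-elim (<⇒≱ d<i (subst₂ _≤_ (length-interval 0 i)
          (trans (cong length (bsum-replicate d)) (length-interval 0 d))
          (≼⇒length≤ (interval 0 i) (bsum (ones d)) (≼-intro (from T-≡ e)))))
  found : containsX (ones i) ≡ true
  found = ≼⇒contains≡true (subst (interval 0 i ≼_) (sym (bsum-replicate i)) (≼-refl (interval 0 i)))
  from-ones : ∀ t d → d + t ≡ i → 1 ≤ paths m (ones d) (t + m)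
  from-ones zero d d≡i rewrite +-identityʳ d | d≡i = begin
    1                   ≡⟨ cong χ (≡ᵇ-refl m) ⟨
    χ (m ≡ᵇ m)          ≡⟨ paths-found m (ones i) m found ⟨
    paths m (ones i) m  ∎
  from-ones (suc t) d d+t≡i = begin
    1                                    ≤⟨ from-ones t (suc d) (trans (sym (+-suc d t)) d+t≡i) ⟩
    paths m (ones (suc d)) (t + m)       ≡⟨ cong (λ p → paths m p (t + m)) (replicate-snoc d 1) ⟨
    paths m (ones d ++ [ 1 ]) (t + m)    ≤⟨ paths-extend m (ones d) 0 (t + m) (missing d (subst (d <_) d+t≡i (m<m+n d z<s))) ⟩
    paths m (ones d) (suc t + m)         ∎

wilf-a-prefix : ∀ i α β → EmptyOrStartsWithB α → EmptyOrStartsWithB β →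
  WilfEq (upTo i ⊕ α) (upTo i ⊕ β) ⇔ WilfEq α β
wilf-a-prefix i α β hα hβ rewrite upTo≡interval i =
  Greedy.wilf⇔ (interval 0 i) (interval-bounded i) (a-paths-positive i) (a-splittable α hα i) (a-splittable β hβ i)

wilf-b-prefix : ∀ k α β → WilfEq (block (2 + k) ⊕ α) (block (2 + k) ⊕ β) ⇔ WilfEq α β
wilf-b-prefix k α β =
  Greedy.wilf⇔ (block (2 + k)) (block-bounded (2 + k)) (b-paths-positive k) (b-splittable k α) (b-splittable k β)

wordPerm-shape : ∀ A → ValidWord A → ¬ StartsWithA A → EmptyOrStartsWithB (wordPerm A)
wordPerm-shape [] _ _ = inj₁ refl
wordPerm-shape (a _ ∷ A) _ ¬startsA = ⊥-elim (¬startsA tt)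
wordPerm-shape (b (suc (suc k)) ∷ A) _ _ =
  inj₂ (_ , refl , ∈-++⁺ˡ (∈-++⁺ʳ (map suc (applyUpTo suc k)) (here refl)))
wordPerm-shape (b 0 ∷ A) ((() ∷ _) , _) _
wordPerm-shape (b 1 ∷ A) ((s≤s () ∷ _) , _) _

mainTheorem10 : ((A B : Word) → ValidWord A → ValidWord B → (i : _) → 1 ≤ i →
      ¬ StartsWithA A → ¬ StartsWithA B →
      (WilfEq (wordPerm (a i ∷ A)) (wordPerm (a i ∷ B)) ⇔ WilfEq (wordPerm A) (wordPerm B)))
    ×
    ((A B : Word) → ValidWord A → ValidWord B → (j : _) → 2 ≤ j →
      (WilfEq (wordPerm (b j ∷ A)) (wordPerm (b j ∷ B)) ⇔ WilfEq (wordPerm A) (wordPerm B)))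
mainTheorem10 =
  (λ A B vA vB i _ ¬startsA ¬startsB →
     wilf-a-prefix i (wordPerm A) (wordPerm B) (wordPerm-shape A vA ¬startsA) (wordPerm-shape B vB ¬startsB)) ,
  λ { A B _ _ (suc (suc k)) _ → wilf-b-prefix k (wordPerm A) (wordPerm B)
    ; _ _ _ _ 1 (s≤s ()) }
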